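{- Let $a,b\in\mathbb{Z}[i]\setminus\{0\}$ have Gauss remainder $r$ with $r\neq0$ and $v_2(r)\leq v_2(b)$. Then $\phi_{\mathbb{Z}[i]}(r)<\phi_{\mathbb{Z}[i]}(b)$.
   Context: $\mathbb{Z}[i]$ has norm $\mathrm{Nm}(x+yi)=x^2+y^2$. A function $f:\mathbb{Z}[i]\setminus\{0\}\to W$ ($W$ a well-ordered set having $\mathbb{N}$ as an initial segment) is Euclidean if for all nonzero $a,b$ there exist $q,r$ with $a=qb+r$ and either $r=0$ or $f(r)<f(b)$. $\phi_{\mathbb{Z}[i]}$ is the minimal Euclidean function, the pointwise minimum of all Euclidean functions (equivalently, the minimal $n$ such that $z=\sum_{j=0}^n u_j(1+i)^j$ with $u_j\in\{0,\pm1,\pm i\}$, $u_n\ne0$). Gauss remainder: write $a\bar b/\mathrm{Nm}(b)=\alpha+\beta i$; let $\lfloor x\rceil=\lfloor x\rfloor$ if $0\le x-\lfloor x\rfloor\le1/2$ and $\lceil x\rceil$ otherwise; $q=\lfloor\alpha\rceil+\lfloor\beta\rceil i$ and $r=a-qb$. $v_2(z)$ for nonzero $z\in\mathbb{Z}[i]$ is the largest $j$ with $2^j\mid z$ in $\mathbb{Z}[i]$ (the 2-adic valuation of $\gcd(\Re z,\Im z)$). -}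

module Defs where

open import Data.Nat as ℕ using (ℕ; zero; suc; _≤ᵇ_)
open import Data.Integer as ℤ using (ℤ; +_; _/ℕ_; _%ℕ_)
open import Data.Bool using (if_then_else_)
open import Data.Fin as Fin using (Fin; toℕ; fromℕ)
open import Data.Product using (Σ; ∃; _×_)
open import Relation.Binary.PropositionalEquality using (_≡_)
open import Relation.Nullary using (¬_)

record ℤ[i] : Set where
  constructor _+_i
  field
    re : ℤ
    im : ℤ
open ℤ[i] public

0g 1g ig 2g : ℤ[i]
0g = (+ 0) + (+ 0) i
1g = (+ 1) + (+ 0) i
ig = (+ 0) + (+ 1) i
2g = (+ 2) + (+ 0) i

infixl 6 _⊕_ _⊖_
infixl 7 _⊗_

_⊕_ : ℤ[i] → ℤ[i] → ℤ[i]
(a + b i) ⊕ (c + d i) = (a ℤ.+ c) + (b ℤ.+ d) i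

_⊖_ : ℤ[i] → ℤ[i] → ℤ[i]
(a + b i) ⊖ (c + d i) = (a ℤ.- c) + (b ℤ.- d) i

_⊗_ : ℤ[i] → ℤ[i] → ℤ[i]
(a + b i) ⊗ (c + d i) = (a ℤ.* c ℤ.- b ℤ.* d) + (a ℤ.* d ℤ.+ b ℤ.* c) i

conj : ℤ[i] → ℤ[i]
conj (a + b i) = a + (ℤ.- b) i

_^g_ : ℤ[i] → ℕ → ℤ[i]
z ^g zero = 1g
z ^g suc n = z ⊗ (z ^g n)

Nm : ℤ[i] → ℕ
Nm (x + y i) = ℤ.∣ x ℤ.* x ℤ.+ y ℤ.* y ∣

-- ⌊ p / N ⌉ for N > 0: floor(p/N) if frac(p/N) ≤ 1/2, else ceil(p/N)
-- (frac > 1/2 implies p/N is not an integer, so ceil = floor + 1).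
-- The N = 0 case is never used (b ≠ 0).
roundDiv : ℤ → ℕ → ℤ
roundDiv p zero = + 0
roundDiv p N@(suc _) =
  if (2 ℕ.* (p %ℕ N)) ≤ᵇ N then p /ℕ N else (p /ℕ N) ℤ.+ + 1

-- Gauss quotient and remainder: a b̄ / Nm(b) = α + β i,
-- q = ⌊α⌉ + ⌊β⌉ i,  r = a - q b
gaussQuot : ℤ[i] → ℤ[i] → ℤ[i]
gaussQuot a b =
  roundDiv (re (a ⊗ conj b)) (Nm b) + roundDiv (im (a ⊗ conj b)) (Nm b) i

gaussRem : ℤ[i] → ℤ[i] → ℤ[i]
gaussRem a b = a ⊖ gaussQuot a b ⊗ b

_∣g_ : ℤ[i] → ℤ[i] → Set
d ∣g z = Σ ℤ[i] λ w → z ≡ d ⊗ w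

IsV2 : ℤ[i] → ℕ → Set
IsV2 z j = ((2g ^g j) ∣g z) × ¬ ((2g ^g suc j) ∣g z)

data Digit : Set where
  d0 d1 dm1 di dmi : Digit

digit : Digit → ℤ[i]
digit d0 = 0g
digit d1 = 1g
digit dm1 = (ℤ.- + 1) + (+ 0) i
digit di = ig
digit dmi = (+ 0) + (ℤ.- + 1) i

1+i : ℤ[i]
1+i = (+ 1) + (+ 1) i

sumG : (m : ℕ) → (Fin m → ℤ[i]) → ℤ[i]
sumG zero f = 0g
sumG (suc m) f = f Fin.zero ⊕ sumG m (λ j → f (Fin.suc j))

HasExpansion : ℤ[i] → ℕ → Set
HasExpansion z n = Σ (Fin (suc n) → Digit) λ u →
  (¬ (u (fromℕ n) ≡ d0)) × (z ≡ sumG (suc n) (λ j → digit (u j) ⊗ (1+i ^g toℕ j)))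

-- φ_{ℤ[i]}(z) = min { n | HasExpansion z n }.
-- φ(r) < φ(b): some expansion length of r is below every expansion length of b.
PhiLt : ℤ[i] → ℤ[i] → Set
PhiLt r b = Σ ℕ λ n → HasExpansion r n × ((m : ℕ) → HasExpansion b m → n ℕ.< m)

{-# OPTIONS --safe #-}
-- Write z = 2^k z′ with 2 ∤ z′, and let Box n be the set of x + y i with |x|, |y| ≤ W n and
-- |x| + |y| < W (n + 1), where W = 1, 2, 4, 6, 10, 14, … and W (n + 2) = 2 W n + 2.  Then
-- φ(z) = 2k + min {n ∣ z′ ∈ Box n}; only the two inequalities are needed.  A point z′ ∈ Box (n + 1)
-- with 2 ∤ z′ can be written u + (1+i) w with u ∈ {0, ±1, ±i}, 2 ∤ w and w ∈ Box n, so it has an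
-- expansion of length at most n + 1.  Conversely, induction on the length shows that an expansion
-- of length m of z has m = 2k + M with z′ ∈ Box M.
-- The Gauss remainder r of a by b satisfies 2 |Re(r b̄)|, 2 |Im(r b̄)| ≤ Nm b.  Writing r = 2^j r′ and
-- b = 2^(j+d) b′ (d ≥ 0 is the valuation hypothesis), this bound together with b′ ∈ Box M forces
-- r′ ∈ Box (2d + M − 1); for d = 0 the bounds have to be sharpened by one, which comes from Nm b′
-- being odd or else both parts of b′ being odd.  Hence r has an expansion of length 2j + 2d + M − 1,
-- shorter than any expansion of b.

module Submission where

open import Data.Bool as Bool using (true; false)
open import Data.Empty using (⊥-elim)
open import Data.Fin as Fin using (Fin; toℕ)
open import Data.Integer as ℤ using (ℤ; +_; -[1+_]; ∣_∣; _◃_)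
import Data.Integer.DivMod as ℤ
import Data.Integer.Properties as ℤ
import Data.Integer.Tactic.RingSolver as ℤ-Ring
open import Data.List using ([]; _∷_)
open import Data.Nat as ℕ using (ℕ; zero; suc; _+_; _*_; _∸_; _^_; _≤_; _<_; z≤n; s≤s)
import Data.Nat.Properties as ℕ
import Data.Nat.Tactic.RingSolver as ℕ-Ring
open import Algebra.Properties.CommutativeSemigroup ℕ.+-commutativeSemigroup
  using () renaming (interchange to +-interchange)
open import Data.Product using (∃; ∃-syntax; ∃₂; _×_; _,_; proj₁; proj₂; map₁)
open import Data.Sign as Sign using (Sign)
open import Data.Sum using (_⊎_; inj₁; inj₂)
open import Data.Unit using (tt)
import Data.Vec.Functional as Vector
open import Function using (_∘_)
open import Relation.Binary.PropositionalEquality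
open import Relation.Nullary using (¬_; Dec; yes; no)
open import Relation.Nullary.Decidable using (_×-dec_)
open import Relation.Unary using (Decidable)
open import Defs

halve : ∀ n → ∃[ h ] (n ≡ h + h ⊎ n ≡ suc (h + h))
halve zero = 0 , inj₁ refl
halve (suc n) with halve n
... | h , inj₁ n≡h+h   = h , inj₂ (cong suc n≡h+h)
... | h , inj₂ n≡1+h+h = suc h , inj₁ (trans (cong suc n≡1+h+h) (cong suc (sym (ℕ.+-suc h h))))

m+m≢1+n+n : ∀ m n → m + m ≢ suc (n + n)
m+m≢1+n+n zero n ()
m+m≢1+n+n (suc m) n eq = m+m≢1+n+n n m (sym (trans (sym (ℕ.+-suc m m)) (ℕ.suc-injective eq)))

m+m≤n+n⇒m≤n : ∀ m n → m + m ≤ n + n → m ≤ n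
m+m≤n+n⇒m≤n m n le with ℕ.≤-<-connex m n
... | inj₁ m≤n = m≤n
... | inj₂ n<m = ⊥-elim (ℕ.<⇒≱ (ℕ.+-mono-< n<m n<m) le)

1+m+m≤n+n⇒1+m+m<n+n : ∀ m n → suc (m + m) ≤ n + n → suc (m + m) < n + n
1+m+m≤n+n⇒1+m+m<n+n m n le with ℕ.m≤n⇒m<n∨m≡n le
... | inj₁ lt = lt
... | inj₂ eq = ⊥-elim (m+m≢1+n+n n m (sym eq))

m+m<n+n+2⇒m≤n : ∀ m n → m + m < n + n + 2 → m ≤ n
m+m<n+n+2⇒m≤n m n lt with ℕ.≤-<-connex m n
... | inj₁ m≤n = m≤n
... | inj₂ n<m = ⊥-elim (ℕ.<⇒≱ lt (subst (_≤ m + m) (regroup n) (ℕ.+-mono-≤ n<m n<m)))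
  where
  regroup : ∀ n → suc n + suc n ≡ n + n + 2
  regroup = ℕ-Ring.solve-∀

m+m≤1+n+n⇒m≤n : ∀ m n → m + m ≤ suc (n + n) → m ≤ n
m+m≤1+n+n⇒m≤n m n le with ℕ.m≤n⇒m<n∨m≡n le
... | inj₁ lt = m+m≤n+n⇒m≤n m n (ℕ.≤-pred lt)
... | inj₂ eq = ⊥-elim (m+m≢1+n+n m n eq)

[1+c]*s≤c*[1+V]⇒s≤V : ∀ c s V → suc c * s ≤ c * suc V → s ≤ V
[1+c]*s≤c*[1+V]⇒s≤V c s V le with ℕ.≤-<-connex s V
... | inj₁ s≤V = s≤V
... | inj₂ V<s = ⊥-elim (ℕ.<⇒≱ (ℕ.≤-trans (s≤s (ℕ.m≤n+m (c * suc V) V)) (ℕ.*-monoʳ-≤ (suc c) V<s)) le)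

[n∸m]+[n∸m]<n : ∀ {m n} → m ≤ n → n < m + m → (n ∸ m) + (n ∸ m) < n
[n∸m]+[n∸m]<n {m} {n} m≤n n<m+m = subst (δ + δ <_) m+δ≡n (ℕ.+-monoˡ-< δ δ<m)
  where
  δ = n ∸ m
  m+δ≡n : m + δ ≡ n
  m+δ≡n = ℕ.m+[n∸m]≡n m≤n
  δ<m : δ < m
  δ<m with ℕ.≤-<-connex m δ
  ... | inj₂ δ<m = δ<m
  ... | inj₁ m≤δ = ⊥-elim (ℕ.<⇒≱ n<m+m (subst (m + m ≤_) m+δ≡n (ℕ.+-monoʳ-≤ m m≤δ)))

least : ∀ {P : ℕ → Set} → Decidable P → ∀ {n} → P n → ∃[ m ] P m × (∀ {k} → k < m → ¬ P k)
least {P} P? {n} Pn = below (suc n) (n , ℕ.n<1+n n , Pn)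
  where
  below : ∀ v → ∃[ m ] m < v × P m → ∃[ m ] P m × (∀ {k} → k < m → ¬ P k)
  below (suc v) (m , m<1+v , Pm) with ℕ.anyUpTo? P? v
  ... | yes ∃<v = below v ∃<v
  ... | no ∄<v with ℕ.m<1+n⇒m<n∨m≡n m<1+v
  ...   | inj₁ m<v  = ⊥-elim (∄<v (m , m<v , Pm))
  ...   | inj₂ refl = m , Pm , λ k<m Pk → ∄<v (_ , k<m , Pk)

Even Odd : ℤ → Set
Even e = ∃[ h ] e ≡ h ℤ.+ h
Odd e = ∃[ h ] e ≡ h ℤ.+ h ℤ.+ + 1

even⊎odd : ∀ e → Even e ⊎ Odd e
even⊎odd (+ n) with halve n
... | h , inj₁ eq = inj₁ (+ h , cong +_ eq)
... | h , inj₂ eq = inj₂ (+ h , cong +_ (trans eq (ℕ.+-comm 1 (h + h))))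
even⊎odd -[1+ n ] with halve n
... | h , inj₁ refl = inj₂ (-[1+ h ] , sym (ℤ.[1+m]⊖[1+n]≡m⊖n 0 (suc (h + h))))
... | h , inj₂ refl = inj₁ (-[1+ h ] , refl)

even⇒¬odd : ∀ {e} → Even e → ¬ Odd e
even⇒¬odd (h , refl) (k , eq) = 2t≢1 (h ℤ.- k) (begin
  (h ℤ.- k) ℤ.+ (h ℤ.- k)                            ≡⟨ regroup h k ⟩
  ((h ℤ.+ h) ℤ.- (k ℤ.+ k ℤ.+ + 1)) ℤ.+ + 1          ≡⟨ cong (λ x → (x ℤ.- (k ℤ.+ k ℤ.+ + 1)) ℤ.+ + 1) eq ⟩
  ((k ℤ.+ k ℤ.+ + 1) ℤ.- (k ℤ.+ k ℤ.+ + 1)) ℤ.+ + 1  ≡⟨ cong (ℤ._+ + 1) (ℤ.+-inverseʳ (k ℤ.+ k ℤ.+ + 1)) ⟩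
  + 1                                                ∎)
  where
  open ≡-Reasoning
  2t≢1 : ∀ t → t ℤ.+ t ≢ + 1
  2t≢1 (+ n) eq = m+m≢1+n+n n 0 (ℤ.+-injective eq)
  2t≢1 -[1+ n ] ()
  regroup : ∀ h k → (h ℤ.- k) ℤ.+ (h ℤ.- k) ≡ ((h ℤ.+ h) ℤ.- (k ℤ.+ k ℤ.+ + 1)) ℤ.+ + 1
  regroup = ℤ-Ring.solve-∀

even+even : ∀ {a b} → Even a → Even b → Even (a ℤ.+ b)
even+even (h , refl) (k , refl) = h ℤ.+ k , ℤ-Ring.solve (h ∷ k ∷ [])

odd+odd : ∀ {a b} → Odd a → Odd b → Even (a ℤ.+ b)
odd+odd (h , refl) (k , refl) = h ℤ.+ k ℤ.+ + 1 , ℤ-Ring.solve (h ∷ k ∷ [])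

even+odd : ∀ {a b} → Even a → Odd b → Odd (a ℤ.+ b)
even+odd (h , refl) (k , refl) = h ℤ.+ k , ℤ-Ring.solve (h ∷ k ∷ [])

odd+even : ∀ {a b} → Odd a → Even b → Odd (a ℤ.+ b)
odd+even (h , refl) (k , refl) = h ℤ.+ k , ℤ-Ring.solve (h ∷ k ∷ [])

neg-even : ∀ {a} → Even a → Even (ℤ.- a)
neg-even (h , refl) = ℤ.- h , ℤ-Ring.solve (h ∷ [])

neg-odd : ∀ {a} → Odd a → Odd (ℤ.- a)
neg-odd (h , refl) = ℤ.- h ℤ.- + 1 , ℤ-Ring.solve (h ∷ [])

∣even∣ : ∀ {e} → Even e → ∃[ m ] ∣ e ∣ ≡ m + m
∣even∣ (+ n , refl) = n , refl
∣even∣ (-[1+ n ] , refl) = suc n , cong suc (sym (ℕ.+-suc n n))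

∣odd∣ : ∀ {e} → Odd e → ∃[ a ] ∣ e ∣ ≡ suc (a + a)
∣odd∣ {+ n} o with halve n
... | h , inj₁ refl = ⊥-elim (even⇒¬odd (+ h , refl) o)
... | h , inj₂ eq   = h , eq
∣odd∣ { -[1+ n ]} o with halve n
... | h , inj₁ eq   = h , cong suc eq
... | h , inj₂ refl = ⊥-elim (even⇒¬odd (-[1+ h ] , refl) o)

∣1+a+a∣⇒odd : ∀ e a → ∣ e ∣ ≡ suc (a + a) → Odd e
∣1+a+a∣⇒odd e a eq with even⊎odd e
... | inj₁ ev = ⊥-elim (m+m≢1+n+n (proj₁ (∣even∣ ev)) a (trans (sym (proj₂ (∣even∣ ev))) eq))
... | inj₂ od = od

odd⇒∣m∣+∣n∣-odd : ∀ m n → Odd (m ℤ.+ n) → ∃[ t ] ∣ m ∣ + ∣ n ∣ ≡ suc (t + t)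
odd⇒∣m∣+∣n∣-odd m n o with even⊎odd m | even⊎odd n
... | inj₁ e₁ | inj₁ e₂ = ⊥-elim (even⇒¬odd (even+even e₁ e₂) o)
... | inj₂ o₁ | inj₂ o₂ = ⊥-elim (even⇒¬odd (odd+odd o₁ o₂) o)
... | inj₁ e₁ | inj₂ o₂ = even+odd-abs (∣even∣ e₁) (∣odd∣ o₂)
  where
  even+odd-abs : ∀ {x y} → ∃[ h ] x ≡ h + h → ∃[ a ] y ≡ suc (a + a) → ∃[ t ] x + y ≡ suc (t + t)
  even+odd-abs (h , refl) (a , refl) = h + a , ℕ-Ring.solve (h ∷ a ∷ [])
... | inj₂ o₁ | inj₁ e₂ = odd+even-abs (∣odd∣ o₁) (∣even∣ e₂)
  where
  odd+even-abs : ∀ {x y} → ∃[ a ] x ≡ suc (a + a) → ∃[ h ] y ≡ h + h → ∃[ t ] x + y ≡ suc (t + t)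
  odd+even-abs (a , refl) (h , refl) = h + a , ℕ-Ring.solve (h ∷ a ∷ [])

record OddSplit (e : ℤ) (a : ℕ) : Set where
  constructor oddSplit
  field
    sign   : Sign
    half   : ℤ
    split  : e ≡ (sign ◃ 1) ℤ.+ (half ℤ.+ half)
    ∣half∣ : ∣ half ∣ ≡ a

odd-splits : ∀ {e} → Odd e → ∃[ a ] ∣ e ∣ ≡ suc (a + a) × OddSplit e a × OddSplit e (suc a)
odd-splits {+ n} o with halve n
... | h , inj₁ refl = ⊥-elim (even⇒¬odd (+ h , refl) o)
... | h , inj₂ refl = h , refl , oddSplit Sign.+ (+ h) refl refl
                            , oddSplit Sign.- (+ suc h) (cong +_ (sym (ℕ.+-suc h h))) refl
odd-splits { -[1+ n ]} o with halve n
... | h , inj₂ refl = ⊥-elim (even⇒¬odd (-[1+ h ] , refl) o)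
... | h , inj₁ refl = h , refl , oddSplit Sign.- (ℤ.- (+ h)) (negate (+ h)) (ℤ.∣-i∣≡∣i∣ (+ h))
                            , oddSplit Sign.+ -[1+ h ] refl refl
  where
  negate : ∀ x → ℤ.- (+ 1 ℤ.+ (x ℤ.+ x)) ≡ -[1+ 0 ] ℤ.+ (ℤ.- x ℤ.+ ℤ.- x)
  negate = ℤ-Ring.solve-∀

∣p+p∣≡∣p∣+∣p∣ : ∀ p → ∣ p ℤ.+ p ∣ ≡ ∣ p ∣ + ∣ p ∣
∣p+p∣≡∣p∣+∣p∣ (+ n) = refl
∣p+p∣≡∣p∣+∣p∣ -[1+ n ] = cong suc (sym (ℕ.+-suc n n))

∣p+q∣+∣p-q∣≤V+V : ∀ p q V → ∣ p ∣ ≤ V → ∣ q ∣ ≤ V → ∣ p ℤ.+ q ∣ + ∣ p ℤ.- q ∣ ≤ V + V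
∣p+q∣+∣p-q∣≤V+V p q V ∣p∣≤V ∣q∣≤V =
  by-signs (ℤ.+∣i∣≡i⊎+∣i∣≡-i (p ℤ.+ q)) (ℤ.+∣i∣≡i⊎+∣i∣≡-i (p ℤ.- q))
  where
  upper : ∀ {r} → ∣ r ∣ ≤ V → r ℤ.+ r ℤ.≤ + (V + V)
  upper {+ n}      h = ℤ.+≤+ (ℕ.+-mono-≤ h h)
  upper { -[1+ n ]} h = ℤ.-≤+
  lower : ∀ {r} → ∣ r ∣ ≤ V → ℤ.- r ℤ.+ ℤ.- r ℤ.≤ + (V + V)
  lower {r} h = upper {ℤ.- r} (subst (_≤ V) (sym (ℤ.∣-i∣≡∣i∣ r)) h)
  bound : ∀ {E F} → F ℤ.≤ + (V + V) → + ∣ p ℤ.+ q ∣ ℤ.+ + ∣ p ℤ.- q ∣ ≡ E → E ≡ F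
        → ∣ p ℤ.+ q ∣ + ∣ p ℤ.- q ∣ ≤ V + V
  bound h e₁ e₂ = ℤ.drop‿+≤+ (ℤ.≤-trans (ℤ.≤-reflexive (trans e₁ e₂)) h)
  by-signs : (+ ∣ p ℤ.+ q ∣ ≡ p ℤ.+ q) ⊎ (+ ∣ p ℤ.+ q ∣ ≡ ℤ.- (p ℤ.+ q))
           → (+ ∣ p ℤ.- q ∣ ≡ p ℤ.- q) ⊎ (+ ∣ p ℤ.- q ∣ ≡ ℤ.- (p ℤ.- q))
           → ∣ p ℤ.+ q ∣ + ∣ p ℤ.- q ∣ ≤ V + V
  by-signs (inj₁ e₁) (inj₁ e₂) = bound (upper {p} ∣p∣≤V) (cong₂ ℤ._+_ e₁ e₂) (ℤ-Ring.solve (p ∷ q ∷ []))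
  by-signs (inj₁ e₁) (inj₂ e₂) = bound (upper {q} ∣q∣≤V) (cong₂ ℤ._+_ e₁ e₂) (ℤ-Ring.solve (p ∷ q ∷ []))
  by-signs (inj₂ e₁) (inj₁ e₂) = bound (lower {q} ∣q∣≤V) (cong₂ ℤ._+_ e₁ e₂) (ℤ-Ring.solve (p ∷ q ∷ []))
  by-signs (inj₂ e₁) (inj₂ e₂) = bound (lower {p} ∣p∣≤V) (cong₂ ℤ._+_ e₁ e₂) (ℤ-Ring.solve (p ∷ q ∷ []))

∣p±q∣≤V⇒∣p∣+∣q∣≤V : ∀ p q V → ∣ p ℤ.+ q ∣ ≤ V → ∣ p ℤ.- q ∣ ≤ V → ∣ p ∣ + ∣ q ∣ ≤ V
∣p±q∣≤V⇒∣p∣+∣q∣≤V p q V h₁ h₂ = m+m≤n+n⇒m≤n (∣ p ∣ + ∣ q ∣) V (begin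
  (∣ p ∣ + ∣ q ∣) + (∣ p ∣ + ∣ q ∣)          ≡⟨ +-interchange (∣ p ∣) (∣ q ∣) (∣ p ∣) (∣ q ∣) ⟩
  (∣ p ∣ + ∣ p ∣) + (∣ q ∣ + ∣ q ∣)          ≡⟨ sym (cong₂ _+_ (∣p+p∣≡∣p∣+∣p∣ p) (∣p+p∣≡∣p∣+∣p∣ q)) ⟩
  ∣ p ℤ.+ p ∣ + ∣ q ℤ.+ q ∣                  ≡⟨ sym (cong₂ _+_ (cong ∣_∣ sum) (cong ∣_∣ difference)) ⟩
  ∣ (p ℤ.+ q) ℤ.+ (p ℤ.- q) ∣ + ∣ (p ℤ.+ q) ℤ.- (p ℤ.- q) ∣ ≤⟨ ∣p+q∣+∣p-q∣≤V+V (p ℤ.+ q) (p ℤ.- q) V h₁ h₂ ⟩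
  V + V                                      ∎)
  where
  open ℕ.≤-Reasoning
  sum : (p ℤ.+ q) ℤ.+ (p ℤ.- q) ≡ p ℤ.+ p
  sum = ℤ-Ring.solve (p ∷ q ∷ [])
  difference : (p ℤ.+ q) ℤ.- (p ℤ.- q) ≡ q ℤ.+ q
  difference = ℤ-Ring.solve (p ∷ q ∷ [])

⊗-comm : ∀ z w → z ⊗ w ≡ w ⊗ z
⊗-comm (a + b i) (c + d i) = cong₂ _+_i (ℤ-Ring.solve (a ∷ b ∷ c ∷ d ∷ [])) (ℤ-Ring.solve (a ∷ b ∷ c ∷ d ∷ []))

⊗-assoc : ∀ z w v → z ⊗ (w ⊗ v) ≡ (z ⊗ w) ⊗ v
⊗-assoc (a + b i) (c + d i) (e + f i) = cong₂ _+_i (real a b c d e f) (imaginary a b c d e f)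
  where
  real : ∀ a b c d e f → a ℤ.* (c ℤ.* e ℤ.- d ℤ.* f) ℤ.- b ℤ.* (c ℤ.* f ℤ.+ d ℤ.* e)
                       ≡ (a ℤ.* c ℤ.- b ℤ.* d) ℤ.* e ℤ.- (a ℤ.* d ℤ.+ b ℤ.* c) ℤ.* f
  real = ℤ-Ring.solve-∀
  imaginary : ∀ a b c d e f → a ℤ.* (c ℤ.* f ℤ.+ d ℤ.* e) ℤ.+ b ℤ.* (c ℤ.* e ℤ.- d ℤ.* f)
                            ≡ (a ℤ.* c ℤ.- b ℤ.* d) ℤ.* f ℤ.+ (a ℤ.* d ℤ.+ b ℤ.* c) ℤ.* e
  imaginary = ℤ-Ring.solve-∀

⊗-distribˡ-⊕ : ∀ c z w → c ⊗ (z ⊕ w) ≡ c ⊗ z ⊕ c ⊗ w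
⊗-distribˡ-⊕ (a + b i) (c + d i) (e + f i) = cong₂ _+_i (real a b c d e f) (imaginary a b c d e f)
  where
  real : ∀ a b c d e f → a ℤ.* (c ℤ.+ e) ℤ.- b ℤ.* (d ℤ.+ f) ≡ (a ℤ.* c ℤ.- b ℤ.* d) ℤ.+ (a ℤ.* e ℤ.- b ℤ.* f)
  real = ℤ-Ring.solve-∀
  imaginary : ∀ a b c d e f → a ℤ.* (d ℤ.+ f) ℤ.+ b ℤ.* (c ℤ.+ e) ≡ (a ℤ.* d ℤ.+ b ℤ.* c) ℤ.+ (a ℤ.* f ℤ.+ b ℤ.* e)
  imaginary = ℤ-Ring.solve-∀

⊗-swap : ∀ z w v → z ⊗ (w ⊗ v) ≡ w ⊗ (z ⊗ v)
⊗-swap z w v = trans (⊗-assoc z w v) (trans (cong (_⊗ v) (⊗-comm z w)) (sym (⊗-assoc w z v)))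

⊕-identityˡ : ∀ z → 0g ⊕ z ≡ z
⊕-identityˡ (a + b i) = cong₂ _+_i (ℤ.+-identityˡ a) (ℤ.+-identityˡ b)

⊕-identityʳ : ∀ z → z ⊕ 0g ≡ z
⊕-identityʳ (a + b i) = cong₂ _+_i (ℤ.+-identityʳ a) (ℤ.+-identityʳ b)

⊗-identityʳ : ∀ z → z ⊗ 1g ≡ z
⊗-identityʳ (a + b i) = cong₂ _+_i (ℤ-Ring.solve (a ∷ b ∷ [])) (ℤ-Ring.solve (a ∷ b ∷ []))

⊗-identityˡ : ∀ z → 1g ⊗ z ≡ z
⊗-identityˡ z = trans (⊗-comm 1g z) (⊗-identityʳ z)

⊗-zeroʳ : ∀ z → z ⊗ 0g ≡ 0g
⊗-zeroʳ (a + b i) = cong₂ _+_i (ℤ-Ring.solve (a ∷ b ∷ [])) (ℤ-Ring.solve (a ∷ b ∷ []))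

scalar⊗ : ∀ c a b → (c + (+ 0) i) ⊗ (a + b i) ≡ (c ℤ.* a) + (c ℤ.* b) i
scalar⊗ c a b = cong₂ _+_i (ℤ-Ring.solve (c ∷ a ∷ b ∷ [])) (ℤ-Ring.solve (c ∷ a ∷ b ∷ []))

2g^k≡ : ∀ k → 2g ^g k ≡ (+ (2 ^ k)) + (+ 0) i
2g^k≡ zero = refl
2g^k≡ (suc k) = trans (cong (2g ⊗_) (2g^k≡ k))
  (trans (scalar⊗ (+ 2) (+ (2 ^ k)) (+ 0)) (cong₂ _+_i (sym (ℤ.pos-* 2 (2 ^ k))) (ℤ.*-zeroʳ (+ 2))))

2g^k⊗z≡ : ∀ k z → (2g ^g k) ⊗ z ≡ (+ (2 ^ k) ℤ.* re z) + (+ (2 ^ k) ℤ.* im z) i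
2g^k⊗z≡ k (a + b i) = trans (cong (_⊗ (a + b i)) (2g^k≡ k)) (scalar⊗ (+ (2 ^ k)) a b)

1+i⊗z≡ : ∀ z → 1+i ⊗ z ≡ (re z ℤ.- im z) + (re z ℤ.+ im z) i
1+i⊗z≡ (a + b i) = cong₂ _+_i (ℤ-Ring.solve (a ∷ b ∷ [])) (ℤ-Ring.solve (a ∷ b ∷ []))

-- (1+i) w has real + imaginary part 2 re w and imaginary − real part 2 im w.
≡u⊕1+i⊗w : ∀ z u w → re z ℤ.+ im z ≡ (re u ℤ.+ im u) ℤ.+ (re w ℤ.+ re w)
          → im z ℤ.- re z ≡ (im u ℤ.- re u) ℤ.+ (im w ℤ.+ im w) → z ≡ u ⊕ 1+i ⊗ w
≡u⊕1+i⊗w (x + y i) (u₁ + u₂ i) (w₁ + w₂ i) e₁ e₂ = cong₂ _+_i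
  (ℤ.*-cancelˡ-≡ (+ 2) _ _ (trans (real x y) (trans (cong₂ ℤ._-_ e₁ e₂) (real′ u₁ u₂ w₁ w₂))))
  (ℤ.*-cancelˡ-≡ (+ 2) _ _ (trans (imaginary x y) (trans (cong₂ ℤ._+_ e₁ e₂) (imaginary′ u₁ u₂ w₁ w₂))))
  where
  real : ∀ x y → + 2 ℤ.* x ≡ (x ℤ.+ y) ℤ.- (y ℤ.- x)
  real = ℤ-Ring.solve-∀
  imaginary : ∀ x y → + 2 ℤ.* y ≡ (x ℤ.+ y) ℤ.+ (y ℤ.- x)
  imaginary = ℤ-Ring.solve-∀
  real′ : ∀ u₁ u₂ w₁ w₂ → ((u₁ ℤ.+ u₂) ℤ.+ (w₁ ℤ.+ w₁)) ℤ.- ((u₂ ℤ.- u₁) ℤ.+ (w₂ ℤ.+ w₂))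
                        ≡ + 2 ℤ.* (u₁ ℤ.+ (+ 1 ℤ.* w₁ ℤ.- + 1 ℤ.* w₂))
  real′ = ℤ-Ring.solve-∀
  imaginary′ : ∀ u₁ u₂ w₁ w₂ → ((u₁ ℤ.+ u₂) ℤ.+ (w₁ ℤ.+ w₁)) ℤ.+ ((u₂ ℤ.- u₁) ℤ.+ (w₂ ℤ.+ w₂))
                             ≡ + 2 ℤ.* (u₂ ℤ.+ (+ 1 ℤ.* w₂ ℤ.+ + 1 ℤ.* w₁))
  imaginary′ = ℤ-Ring.solve-∀

2g⊗z≡ : ∀ z → 2g ⊗ z ≡ (re z ℤ.+ re z) + (im z ℤ.+ im z) i
2g⊗z≡ (a + b i) = cong₂ _+_i (ℤ-Ring.solve (a ∷ b ∷ [])) (ℤ-Ring.solve (a ∷ b ∷ []))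

2g⊗-cancel : ∀ {z w} → 2g ⊗ z ≡ 2g ⊗ w → z ≡ w
2g⊗-cancel {z} {w} eq = cong₂ _+_i (half (cong re eq′)) (half (cong im eq′))
  where
  eq′ = trans (sym (2g⊗z≡ z)) (trans eq (2g⊗z≡ w))
  half : ∀ {x y} → x ℤ.+ x ≡ y ℤ.+ y → x ≡ y
  half {x} {y} e = ℤ.*-cancelˡ-≡ (+ 2) x y (trans (double x) (trans e (sym (double y))))
    where
    double : ∀ x → + 2 ℤ.* x ≡ x ℤ.+ x
    double = ℤ-Ring.solve-∀

2g^k⊗-cancel : ∀ k {z w} → (2g ^g k) ⊗ z ≡ (2g ^g k) ⊗ w → z ≡ w
2g^k⊗-cancel zero {z} {w} eq = trans (sym (⊗-identityˡ z)) (trans eq (⊗-identityˡ w))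
2g^k⊗-cancel (suc k) {z} {w} eq =
  2g^k⊗-cancel k (2g⊗-cancel (trans (⊗-assoc 2g (2g ^g k) z) (trans eq (sym (⊗-assoc 2g (2g ^g k) w)))))

2∤_ : ℤ[i] → Set
2∤ z = ¬ (2g ∣g z)

2∣⇒even-parts : ∀ {z} → 2g ∣g z → Even (re z) × Even (im z)
2∣⇒even-parts (w , refl) = (re w , cong re (2g⊗z≡ w)) , (im w , cong im (2g⊗z≡ w))

even-parts⇒2∣ : ∀ {z} → Even (re z) → Even (im z) → 2g ∣g z
even-parts⇒2∣ (h , e₁) (k , e₂) = h + k i , trans (cong₂ _+_i e₁ e₂) (sym (2g⊗z≡ (h + k i)))

odd-re⇒2∤ : ∀ {z} → Odd (re z) → 2∤ z
odd-re⇒2∤ o d = even⇒¬odd (proj₁ (2∣⇒even-parts d)) o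

odd-im⇒2∤ : ∀ {z} → Odd (im z) → 2∤ z
odd-im⇒2∤ o d = even⇒¬odd (proj₂ (2∣⇒even-parts d)) o

odd-re+im⇒2∤ : ∀ {z} → Odd (re z ℤ.+ im z) → 2∤ z
odd-re+im⇒2∤ o d = even⇒¬odd (even+even (proj₁ (2∣⇒even-parts d)) (proj₂ (2∣⇒even-parts d))) o

2∤⇒≢0 : ∀ {z} → 2∤ z → z ≢ 0g
2∤⇒≢0 2∤z refl = 2∤z (0g , refl)

data OddParts (z : ℤ[i]) : Set where
  odd-even : Odd (re z) → Even (im z) → OddParts z
  even-odd : Even (re z) → Odd (im z) → OddParts z
  odd-odd  : Odd (re z) → Odd (im z) → OddParts z

2∤⇒oddParts : ∀ {z} → 2∤ z → OddParts z
2∤⇒oddParts {z} 2∤z with even⊎odd (re z) | even⊎odd (im z)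
... | inj₁ e₁ | inj₁ e₂ = ⊥-elim (2∤z (even-parts⇒2∣ e₁ e₂))
... | inj₁ e₁ | inj₂ o₂ = even-odd e₁ o₂
... | inj₂ o₁ | inj₁ e₂ = odd-even o₁ e₂
... | inj₂ o₁ | inj₂ o₂ = odd-odd o₁ o₂

∥_∥₁ : ℤ[i] → ℕ
∥ z ∥₁ = ∣ re z ∣ + ∣ im z ∣

∥z∥₁≡0⇒z≡0 : ∀ z → ∥ z ∥₁ ≡ 0 → z ≡ 0g
∥z∥₁≡0⇒z≡0 z e = cong₂ _+_i (ℤ.∣i∣≡0⇒i≡0 (ℕ.m+n≡0⇒m≡0 ∣ re z ∣ e)) (ℤ.∣i∣≡0⇒i≡0 (ℕ.m+n≡0⇒n≡0 ∣ re z ∣ e))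

∥2g⊗z∥₁≡∥z∥₁+∥z∥₁ : ∀ z → ∥ 2g ⊗ z ∥₁ ≡ ∥ z ∥₁ + ∥ z ∥₁
∥2g⊗z∥₁≡∥z∥₁+∥z∥₁ z = begin
  ∥ 2g ⊗ z ∥₁                                   ≡⟨ cong ∥_∥₁ (2g⊗z≡ z) ⟩
  ∣ re z ℤ.+ re z ∣ + ∣ im z ℤ.+ im z ∣          ≡⟨ cong₂ _+_ (∣p+p∣≡∣p∣+∣p∣ (re z)) (∣p+p∣≡∣p∣+∣p∣ (im z)) ⟩
  (∣ re z ∣ + ∣ re z ∣) + (∣ im z ∣ + ∣ im z ∣)  ≡⟨ +-interchange (∣ re z ∣) (∣ re z ∣) (∣ im z ∣) (∣ im z ∣) ⟩
  ∥ z ∥₁ + ∥ z ∥₁                               ∎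
  where open ≡-Reasoning

record OddPart (z : ℤ[i]) : Set where
  constructor oddPart
  field
    exponent : ℕ
    odd      : ℤ[i]
    factor   : z ≡ (2g ^g exponent) ⊗ odd
    2∤odd    : 2∤ odd

oddPart-of : ∀ z → z ≢ 0g → OddPart z
oddPart-of z = go (∥ z ∥₁) z ℕ.≤-refl
  where
  go : ∀ f z → ∥ z ∥₁ ≤ f → z ≢ 0g → OddPart z
  go f z _ _ with even⊎odd (re z) | even⊎odd (im z)
  go f z _ _ | inj₂ o₁ | _       = oddPart 0 z (sym (⊗-identityˡ z)) (odd-re⇒2∤ o₁)
  go f z _ _ | inj₁ _  | inj₂ o₂ = oddPart 0 z (sym (⊗-identityˡ z)) (odd-im⇒2∤ o₂)
  go f z ∥z∥≤f z≢0 | inj₁ e₁ | inj₁ e₂ with even-parts⇒2∣ e₁ e₂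
  ... | w , refl = shift (descend f ∥w∥<f)
    where
    w≢0 : w ≢ 0g
    w≢0 w≡0 = z≢0 (trans (cong (2g ⊗_) w≡0) (⊗-zeroʳ 2g))
    ∥w∥<f : ∥ w ∥₁ < f
    ∥w∥<f = ℕ.<-≤-trans (ℕ.m<m+n ∥ w ∥₁ (ℕ.n≢0⇒n>0 (w≢0 ∘ ∥z∥₁≡0⇒z≡0 w)))
                        (subst (_≤ f) (∥2g⊗z∥₁≡∥z∥₁+∥z∥₁ w) ∥z∥≤f)
    descend : ∀ f → ∥ w ∥₁ < f → OddPart w
    descend (suc f) (s≤s ∥w∥≤f) = go f w ∥w∥≤f w≢0
    shift : OddPart w → OddPart (2g ⊗ w)
    shift (oddPart k w′ eq 2∤w′) = oddPart (suc k) w′ (trans (cong (2g ⊗_) eq) (⊗-assoc 2g (2g ^g k) w′)) 2∤w′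

oddPart-unique : ∀ k k′ {z z′} → (2g ^g k) ⊗ z ≡ (2g ^g k′) ⊗ z′ → 2∤ z → 2∤ z′ → k ≡ k′ × z ≡ z′
oddPart-unique zero zero {z} {z′} eq _ _ = refl , trans (sym (⊗-identityˡ z)) (trans eq (⊗-identityˡ z′))
oddPart-unique (suc k) zero {z} {z′} eq _ 2∤z′ =
  ⊥-elim (2∤z′ ((2g ^g k) ⊗ z , trans (sym (⊗-identityˡ z′)) (trans (sym eq) (sym (⊗-assoc 2g (2g ^g k) z)))))
oddPart-unique zero (suc k′) {z} {z′} eq 2∤z _ =
  ⊥-elim (2∤z ((2g ^g k′) ⊗ z′ , trans (sym (⊗-identityˡ z)) (trans eq (sym (⊗-assoc 2g (2g ^g k′) z′)))))
oddPart-unique (suc k) (suc k′) {z} {z′} eq 2∤z 2∤z′ =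
  map₁ (cong suc) (oddPart-unique k k′ (2g⊗-cancel
    (trans (⊗-assoc 2g (2g ^g k) z) (trans eq (sym (⊗-assoc 2g (2g ^g k′) z′))))) 2∤z 2∤z′)

oddPart⇒IsV2 : ∀ {z} k {z′} → z ≡ (2g ^g k) ⊗ z′ → 2∤ z′ → IsV2 z k
oddPart⇒IsV2 k {z′} eq 2∤z′ = (z′ , eq) , λ where
  (w , eq′) → 2∤z′ (w , 2g^k⊗-cancel k (trans (sym eq)
                 (trans eq′ (trans (sym (⊗-assoc 2g (2g ^g k) w)) (⊗-swap 2g (2g ^g k) w)))))

x*x≡∣x∣*∣x∣ : ∀ x → x ℤ.* x ≡ + (∣ x ∣ * ∣ x ∣)
x*x≡∣x∣*∣x∣ (+ n) = ℤ.+◃n≡+n (n * n)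
x*x≡∣x∣*∣x∣ -[1+ n ] = refl

Nm≡ : ∀ z → Nm z ≡ ∣ re z ∣ * ∣ re z ∣ + ∣ im z ∣ * ∣ im z ∣
Nm≡ z = cong ∣_∣ (cong₂ ℤ._+_ (x*x≡∣x∣*∣x∣ (re z)) (x*x≡∣x∣*∣x∣ (im z)))

+Nm≡ : ∀ z → + Nm z ≡ re z ℤ.* re z ℤ.+ im z ℤ.* im z
+Nm≡ z = trans (cong +_ (Nm≡ z)) (sym (cong₂ ℤ._+_ (x*x≡∣x∣*∣x∣ (re z)) (x*x≡∣x∣*∣x∣ (im z))))

Nm>0 : ∀ {z} → z ≢ 0g → 0 < Nm z
Nm>0 {z} z≢0 = ℕ.n≢0⇒n>0 λ Nm≡0 → z≢0 (∥z∥₁≡0⇒z≡0 z (∥z∥₁≡0 (trans (sym (Nm≡ z)) Nm≡0)))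
  where
  square≡0 : ∀ n → n * n ≡ 0 → n ≡ 0
  square≡0 zero _ = refl
  ∥z∥₁≡0 : ∣ re z ∣ * ∣ re z ∣ + ∣ im z ∣ * ∣ im z ∣ ≡ 0 → ∥ z ∥₁ ≡ 0
  ∥z∥₁≡0 e = cong₂ _+_ (square≡0 ∣ re z ∣ (ℕ.m+n≡0⇒m≡0 _ e)) (square≡0 ∣ im z ∣ (ℕ.m+n≡0⇒n≡0 (∣ re z ∣ * ∣ re z ∣) e))

value : ∀ m → (Fin (suc m) → Digit) → ℤ[i]
value m u = sumG (suc m) (λ j → digit (u j) ⊗ (1+i ^g toℕ j))

sumG-cong : ∀ m {f g : Fin m → ℤ[i]} → (∀ j → f j ≡ g j) → sumG m f ≡ sumG m g
sumG-cong zero    f≗g = refl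
sumG-cong (suc m) f≗g = cong₂ _⊕_ (f≗g Fin.zero) (sumG-cong m (f≗g ∘ Fin.suc))

sumG-distribˡ : ∀ m c (f : Fin m → ℤ[i]) → sumG m (λ j → c ⊗ f j) ≡ c ⊗ sumG m f
sumG-distribˡ zero    c f = sym (⊗-zeroʳ c)
sumG-distribˡ (suc m) c f =
  trans (cong (c ⊗ f Fin.zero ⊕_) (sumG-distribˡ m c (f ∘ Fin.suc))) (sym (⊗-distribˡ-⊕ c _ _))

value-zero : ∀ u → value 0 u ≡ digit (u Fin.zero)
value-zero u = trans (⊕-identityʳ (digit (u Fin.zero) ⊗ 1g)) (⊗-identityʳ (digit (u Fin.zero)))

value-suc : ∀ m u → value (suc m) u ≡ digit (u Fin.zero) ⊕ 1+i ⊗ value m (u ∘ Fin.suc)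
value-suc m u = cong₂ _⊕_ (⊗-identityʳ (digit (u Fin.zero))) (begin
  sumG (suc m) (λ j → digit (u (Fin.suc j)) ⊗ (1+i ⊗ (1+i ^g toℕ j)))
    ≡⟨ sumG-cong (suc m) (λ j → ⊗-swap (digit (u (Fin.suc j))) 1+i (1+i ^g toℕ j)) ⟩
  sumG (suc m) (λ j → 1+i ⊗ (digit (u (Fin.suc j)) ⊗ (1+i ^g toℕ j)))
    ≡⟨ sumG-distribˡ (suc m) 1+i (λ j → digit (u (Fin.suc j)) ⊗ (1+i ^g toℕ j)) ⟩
  1+i ⊗ value m (u ∘ Fin.suc) ∎)
  where open ≡-Reasoning

unit-expansion : ∀ d → d ≢ d0 → HasExpansion (digit d) 0
unit-expansion d d≢0 = (λ _ → d) , d≢0 , sym (value-zero (λ _ → d))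

∷-expansion : ∀ {w l} → HasExpansion w l → ∀ d → HasExpansion (digit d ⊕ 1+i ⊗ w) (suc l)
∷-expansion {w} {l} (u , top≢0 , w≡) d =
  d Vector.∷ u , top≢0 , trans (cong (λ t → digit d ⊕ 1+i ⊗ t) w≡) (sym (value-suc l (d Vector.∷ u)))

-i : ℤ[i]
-i = digit dmi

rotate : Digit → Digit
rotate d0  = d0
rotate d1  = dmi
rotate dm1 = di
rotate di  = d1
rotate dmi = dm1

digit-rotate : ∀ d → digit (rotate d) ≡ -i ⊗ digit d
digit-rotate d0  = refl
digit-rotate d1  = refl
digit-rotate dm1 = refl
digit-rotate di  = refl
digit-rotate dmi = refl

rotate-≢d0 : ∀ {d} → d ≢ d0 → rotate d ≢ d0
rotate-≢d0 {d0}  d≢0 = λ _ → d≢0 refl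
rotate-≢d0 {d1}  d≢0 = λ ()
rotate-≢d0 {dm1} d≢0 = λ ()
rotate-≢d0 {di}  d≢0 = λ ()
rotate-≢d0 {dmi} d≢0 = λ ()

-i⊗-expansion : ∀ {z l} → HasExpansion z l → HasExpansion (-i ⊗ z) l
-i⊗-expansion {z} {l} (u , top≢0 , z≡) = rotate ∘ u , rotate-≢d0 top≢0 , (begin
  -i ⊗ z                                                     ≡⟨ cong (-i ⊗_) z≡ ⟩
  -i ⊗ value l u                                             ≡⟨ sym (sumG-distribˡ (suc l) -i (λ j → digit (u j) ⊗ (1+i ^g toℕ j))) ⟩
  sumG (suc l) (λ j → -i ⊗ (digit (u j) ⊗ (1+i ^g toℕ j)))   ≡⟨ sumG-cong (suc l) rotate-term ⟩
  value l (rotate ∘ u)                                       ∎)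
  where
  open ≡-Reasoning
  rotate-term : ∀ j → -i ⊗ (digit (u j) ⊗ (1+i ^g toℕ j)) ≡ digit (rotate (u j)) ⊗ (1+i ^g toℕ j)
  rotate-term j = trans (⊗-assoc -i (digit (u j)) _) (cong (_⊗ (1+i ^g toℕ j)) (sym (digit-rotate (u j))))

2g⊗-expansion : ∀ {z l} → HasExpansion z l → HasExpansion (2g ⊗ z) (2 + l)
2g⊗-expansion {z} h = subst (λ t → HasExpansion t _) 00-iz≡2z (∷-expansion (∷-expansion (-i⊗-expansion h) d0) d0)
  where
  open ≡-Reasoning
  00-iz≡2z : digit d0 ⊕ 1+i ⊗ (digit d0 ⊕ 1+i ⊗ (-i ⊗ z)) ≡ 2g ⊗ z
  00-iz≡2z = begin
    0g ⊕ 1+i ⊗ (0g ⊕ 1+i ⊗ (-i ⊗ z)) ≡⟨ ⊕-identityˡ (1+i ⊗ (0g ⊕ 1+i ⊗ (-i ⊗ z))) ⟩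
    1+i ⊗ (0g ⊕ 1+i ⊗ (-i ⊗ z))      ≡⟨ cong (1+i ⊗_) (⊕-identityˡ (1+i ⊗ (-i ⊗ z))) ⟩
    1+i ⊗ (1+i ⊗ (-i ⊗ z))           ≡⟨ ⊗-assoc 1+i 1+i (-i ⊗ z) ⟩
    (1+i ⊗ 1+i) ⊗ (-i ⊗ z)           ≡⟨ ⊗-assoc (1+i ⊗ 1+i) -i z ⟩
    2g ⊗ z                           ∎

2g^k⊗-expansion : ∀ {z l} → HasExpansion z l → ∀ k → HasExpansion ((2g ^g k) ⊗ z) (2 * k + l)
2g^k⊗-expansion {z} {l} h zero = subst (λ t → HasExpansion t l) (sym (⊗-identityˡ z)) h
2g^k⊗-expansion {z} {l} h (suc k) =
  subst₂ HasExpansion (⊗-assoc 2g (2g ^g k) z) (length k l) (2g⊗-expansion (2g^k⊗-expansion h k))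
  where
  length : ∀ k l → 2 + (2 * k + l) ≡ 2 * suc k + l
  length = ℕ-Ring.solve-∀

-- The boxes

W : ℕ → ℕ
W zero = 1
W (suc zero) = 2
W (suc (suc n)) = W n + W n + 2

W-suc-even : ∀ n → ∃[ h ] W (suc n) ≡ h + h
W-suc-even zero = 1 , refl
W-suc-even (suc n) = W n + 1 , regroup (W n)
  where
  regroup : ∀ a → a + a + 2 ≡ (a + 1) + (a + 1)
  regroup = ℕ-Ring.solve-∀

W-shift : ∀ e n → W (2 * e + n) + 2 ≡ 2 ^ e * (W n + 2)
W-shift zero n = sym (ℕ.+-identityʳ (W n + 2))
W-shift (suc e) n = begin
  W (2 * suc e + n) + 2                     ≡⟨ cong (λ t → W t + 2) (index e n) ⟩
  W (2 * e + n) + W (2 * e + n) + 2 + 2     ≡⟨ regroup (W (2 * e + n)) ⟩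
  (W (2 * e + n) + 2) + (W (2 * e + n) + 2) ≡⟨ cong (λ t → t + t) (W-shift e n) ⟩
  2 ^ e * (W n + 2) + 2 ^ e * (W n + 2)     ≡⟨ double (2 ^ e) (W n + 2) ⟩
  2 ^ suc e * (W n + 2)                     ∎
  where
  open ≡-Reasoning
  index : ∀ e n → 2 * suc e + n ≡ suc (suc (2 * e + n))
  index = ℕ-Ring.solve-∀
  regroup : ∀ a → a + a + 2 + 2 ≡ (a + 2) + (a + 2)
  regroup = ℕ-Ring.solve-∀
  double : ∀ a b → a * b + a * b ≡ 2 * a * b
  double = ℕ-Ring.solve-∀

2^k*W≤W : ∀ k n → 2 ^ k * W n ≤ W (2 * k + n)
2^k*W≤W k n = ℕ.+-cancelʳ-≤ 2 _ _ (begin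
  2 ^ k * W n + 2         ≤⟨ ℕ.+-monoʳ-≤ (2 ^ k * W n) (ℕ.*-monoʳ-≤ 2 (ℕ.m^n>0 2 k)) ⟩
  2 ^ k * W n + 2 * 2 ^ k ≡⟨ regroup (2 ^ k) (W n) ⟩
  2 ^ k * (W n + 2)       ≡⟨ sym (W-shift k n) ⟩
  W (2 * k + n) + 2       ∎)
  where
  open ℕ.≤-Reasoning
  regroup : ∀ p w → p * w + 2 * p ≡ p * (w + 2)
  regroup = ℕ-Ring.solve-∀

2^[1+k]*W<W : ∀ k n → 2 ^ suc k * W n < W (2 * suc k + n)
2^[1+k]*W<W k n = ℕ.+-cancelʳ-≤ 2 _ _ (begin
  suc (2 ^ suc k * W n) + 2       ≤⟨ ℕ.n≤1+n _ ⟩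
  suc (suc (2 ^ suc k * W n) + 2) ≡⟨ shift (2 ^ suc k * W n) ⟩
  2 ^ suc k * W n + 2 * 2         ≤⟨ ℕ.+-monoʳ-≤ (2 ^ suc k * W n) (ℕ.*-monoʳ-≤ 2 2≤2^[1+k]) ⟩
  2 ^ suc k * W n + 2 * 2 ^ suc k ≡⟨ regroup (2 ^ suc k) (W n) ⟩
  2 ^ suc k * (W n + 2)         ≡⟨ sym (W-shift (suc k) n) ⟩
  W (2 * suc k + n) + 2         ∎)
  where
  open ℕ.≤-Reasoning
  2≤2^[1+k] : 2 ≤ 2 ^ suc k
  2≤2^[1+k] = ℕ.*-monoʳ-≤ 2 (ℕ.m^n>0 2 k)
  shift : ∀ x → suc (suc x + 2) ≡ x + 2 * 2
  shift = ℕ-Ring.solve-∀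
  regroup : ∀ p w → p * w + 2 * p ≡ p * (w + 2)
  regroup = ℕ-Ring.solve-∀

W-suc≤W+W : ∀ n → W (suc n) ≤ W n + W n
W-suc≤W+W zero = ℕ.≤-refl
W-suc≤W+W (suc zero) = ℕ.≤-refl
W-suc≤W+W (suc (suc n)) = begin
  W (suc n) + W (suc n) + 2                 ≤⟨ ℕ.+-monoˡ-≤ 2 (ℕ.+-mono-≤ (W-suc≤W+W n) (W-suc≤W+W n)) ⟩
  (W n + W n) + (W n + W n) + 2             ≤⟨ ℕ.m≤m+n _ 2 ⟩
  (W n + W n) + (W n + W n) + 2 + 2         ≡⟨ regroup (W n) ⟩
  (W n + W n + 2) + (W n + W n + 2)         ∎
  where
  open ℕ.≤-Reasoning
  regroup : ∀ a → (a + a) + (a + a) + 2 + 2 ≡ (a + a + 2) + (a + a + 2)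
  regroup = ℕ-Ring.solve-∀

n<W : ∀ n → n < W n
n<W zero = s≤s z≤n
n<W (suc zero) = s≤s (s≤s z≤n)
n<W (suc (suc n)) = begin
  suc (suc (suc n))          ≤⟨ ℕ.m≤m+n (suc (suc (suc n))) (suc n) ⟩
  suc (suc (suc n)) + suc n  ≡⟨ regroup n ⟩
  suc n + suc n + 2          ≤⟨ ℕ.+-monoˡ-≤ 2 (ℕ.+-mono-≤ (n<W n) (n<W n)) ⟩
  W n + W n + 2              ∎
  where
  open ℕ.≤-Reasoning
  regroup : ∀ n → suc (suc (suc n)) + suc n ≡ suc n + suc n + 2
  regroup = ℕ-Ring.solve-∀

W≢0 : ∀ n → ℕ.NonZero (W n)
W≢0 n = ℕ.>-nonZero (ℕ.≤-<-trans z≤n (n<W n))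

odd≤W⇒odd<W : ∀ n {x} t → x ≡ suc (t + t) → x ≤ W (suc n) → x < W (suc n)
odd≤W⇒odd<W n t refl x≤W with W-suc-even n
... | h , W≡h+h = subst (suc (t + t) <_) (sym W≡h+h)
                    (1+m+m≤n+n⇒1+m+m<n+n t h (subst (suc (t + t) ≤_) W≡h+h x≤W))

Box : ℕ → ℤ[i] → Set
Box n z = ∣ re z ∣ ≤ W n × ∣ im z ∣ ≤ W n × ∥ z ∥₁ < W (suc n)

box? : ∀ n z → Dec (Box n z)
box? n z = (∣ re z ∣ ℕ.≤? W n) ×-dec (∣ im z ∣ ℕ.≤? W n) ×-dec (suc ∥ z ∥₁ ℕ.≤? W (suc n))

∥z∥₁-box : ∀ z → Box ∥ z ∥₁ z
∥z∥₁-box z = ℕ.≤-trans (ℕ.m≤m+n ∣ re z ∣ ∣ im z ∣) (ℕ.<⇒≤ (n<W ∥ z ∥₁))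
           , ℕ.≤-trans (ℕ.m≤n+m ∣ im z ∣ ∣ re z ∣) (ℕ.<⇒≤ (n<W ∥ z ∥₁))
           , ℕ.<-trans (ℕ.n<1+n ∥ z ∥₁) (n<W (suc ∥ z ∥₁))

-- Expansions of the points of a box

ShortExpansion : ℕ → ℤ[i] → Set
ShortExpansion n z = ∃[ l ] l ≤ n × HasExpansion z l

Peeled : ℕ → ℤ[i] → Set
Peeled n z = ∃₂ λ d w → z ≡ digit d ⊕ 1+i ⊗ w × 2∤ w × Box n w

peel : ∀ {n z w} d → z ≡ digit d ⊕ 1+i ⊗ w → ShortExpansion n w → ShortExpansion (suc n) z
peel d refl (l , l≤n , h) = suc l , s≤s l≤n , ∷-expansion h d

box-0⇒expansion : ∀ z → 2∤ z → Box 0 z → ShortExpansion 0 z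
box-0⇒expansion ((+ suc (suc _)) + y i) _ (s≤s () , _ , _)
box-0⇒expansion (-[1+ suc _ ] + y i)   _ (s≤s () , _ , _)
box-0⇒expansion (x + (+ suc (suc _)) i) _ (_ , s≤s () , _)
box-0⇒expansion (x + -[1+ suc _ ] i)   _ (_ , s≤s () , _)
box-0⇒expansion ((+ 0) + (+ 0) i)      2∤z _ = ⊥-elim (2∤⇒≢0 2∤z refl)
box-0⇒expansion ((+ 1) + (+ 0) i)      _ _ = 0 , z≤n , unit-expansion d1 (λ ())
box-0⇒expansion (-[1+ 0 ] + (+ 0) i)   _ _ = 0 , z≤n , unit-expansion dm1 (λ ())
box-0⇒expansion ((+ 0) + (+ 1) i)      _ _ = 0 , z≤n , unit-expansion di (λ ())
box-0⇒expansion ((+ 0) + -[1+ 0 ] i)   _ _ = 0 , z≤n , unit-expansion dmi (λ ())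
box-0⇒expansion ((+ 1) + (+ 1) i)      _ (_ , _ , s≤s (s≤s ()))
box-0⇒expansion ((+ 1) + -[1+ 0 ] i)   _ (_ , _ , s≤s (s≤s ()))
box-0⇒expansion (-[1+ 0 ] + (+ 1) i)   _ (_ , _ , s≤s (s≤s ()))
box-0⇒expansion (-[1+ 0 ] + -[1+ 0 ] i) _ (_ , _ , s≤s (s≤s ()))

∣p+p∣≤∥z∥₁⇒∣p∣≤W : ∀ n p z → ∣ p ℤ.+ p ∣ ≤ ∥ z ∥₁ → Box (suc n) z → ∣ p ∣ ≤ W n
∣p+p∣≤∥z∥₁⇒∣p∣≤W n p z ≤∥z∥ (_ , _ , ∥z∥<W) =
  m+m<n+n+2⇒m≤n ∣ p ∣ (W n) (ℕ.≤-<-trans (subst (_≤ ∥ z ∥₁) (∣p+p∣≡∣p∣+∣p∣ p) ≤∥z∥) ∥z∥<W)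

∣x+y∣≤∥z∥₁ : ∀ z → ∣ re z ℤ.+ im z ∣ ≤ ∥ z ∥₁
∣x+y∣≤∥z∥₁ z = ℤ.∣i+j∣≤∣i∣+∣j∣ (re z) (im z)

∣y-x∣≤∥z∥₁ : ∀ z → ∣ im z ℤ.- re z ∣ ≤ ∥ z ∥₁
∣y-x∣≤∥z∥₁ z = subst (∣ im z ℤ.- re z ∣ ≤_) (ℕ.+-comm ∣ im z ∣ ∣ re z ∣) (ℤ.∣i-j∣≤∣i∣+∣j∣ (im z) (re z))

odd-odd⇒peeled : ∀ {n z} → Odd (re z) → Odd (im z) → Box (suc n) z → Peeled n z
odd-odd⇒peeled {n} {z} (α , x≡) (β , y≡) box@(∣x∣≤W , ∣y∣≤W , _) =
  d0 , w , z≡ , odd-re+im⇒2∤ (β , w₁+w₂≡y) , ∣w₁∣≤W , ∣w₂∣≤W , ∣w₁∣+∣w₂∣<W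
  where
  w₁ w₂ : ℤ
  w₁ = α ℤ.+ β ℤ.+ + 1
  w₂ = β ℤ.- α
  w = w₁ + w₂ i
  w₁+w₂≡y : w₁ ℤ.+ w₂ ≡ β ℤ.+ β ℤ.+ + 1
  w₁+w₂≡y = sum α β
    where
    sum : ∀ α β → (α ℤ.+ β ℤ.+ + 1) ℤ.+ (β ℤ.- α) ≡ β ℤ.+ β ℤ.+ + 1
    sum = ℤ-Ring.solve-∀
  w₁-w₂≡x : w₁ ℤ.- w₂ ≡ α ℤ.+ α ℤ.+ + 1
  w₁-w₂≡x = difference α β
    where
    difference : ∀ α β → (α ℤ.+ β ℤ.+ + 1) ℤ.- (β ℤ.- α) ≡ α ℤ.+ α ℤ.+ + 1
    difference = ℤ-Ring.solve-∀
  x+y≡w₁+w₁ : re z ℤ.+ im z ≡ w₁ ℤ.+ w₁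
  x+y≡w₁+w₁ = trans (cong₂ ℤ._+_ x≡ y≡) (sum α β)
    where
    sum : ∀ α β → (α ℤ.+ α ℤ.+ + 1) ℤ.+ (β ℤ.+ β ℤ.+ + 1) ≡ (α ℤ.+ β ℤ.+ + 1) ℤ.+ (α ℤ.+ β ℤ.+ + 1)
    sum = ℤ-Ring.solve-∀
  y-x≡w₂+w₂ : im z ℤ.- re z ≡ w₂ ℤ.+ w₂
  y-x≡w₂+w₂ = trans (cong₂ ℤ._-_ y≡ x≡) (difference α β)
    where
    difference : ∀ α β → (β ℤ.+ β ℤ.+ + 1) ℤ.- (α ℤ.+ α ℤ.+ + 1) ≡ (β ℤ.- α) ℤ.+ (β ℤ.- α)
    difference = ℤ-Ring.solve-∀
  z≡ : z ≡ digit d0 ⊕ 1+i ⊗ w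
  z≡ = ≡u⊕1+i⊗w z 0g w (trans x+y≡w₁+w₁ (sym (ℤ.+-identityˡ (w₁ ℤ.+ w₁))))
                        (trans y-x≡w₂+w₂ (sym (ℤ.+-identityˡ (w₂ ℤ.+ w₂))))
  ∣w₁∣≤W : ∣ w₁ ∣ ≤ W n
  ∣w₁∣≤W = ∣p+p∣≤∥z∥₁⇒∣p∣≤W n w₁ z (subst (λ t → ∣ t ∣ ≤ ∥ z ∥₁) x+y≡w₁+w₁ (∣x+y∣≤∥z∥₁ z)) box
  ∣w₂∣≤W : ∣ w₂ ∣ ≤ W n
  ∣w₂∣≤W = ∣p+p∣≤∥z∥₁⇒∣p∣≤W n w₂ z (subst (λ t → ∣ t ∣ ≤ ∥ z ∥₁) y-x≡w₂+w₂ (∣y-x∣≤∥z∥₁ z)) box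
  ∣w₁∣+∣w₂∣<W : ∣ w₁ ∣ + ∣ w₂ ∣ < W (suc n)
  ∣w₁∣+∣w₂∣<W with odd⇒∣m∣+∣n∣-odd w₁ w₂ (β , w₁+w₂≡y)
  ... | t , odd-sum = odd≤W⇒odd<W n t odd-sum (∣p±q∣≤V⇒∣p∣+∣q∣≤V w₁ w₂ (W (suc n))
        (subst (λ t → ∣ t ∣ ≤ W (suc n)) (trans y≡ (sym w₁+w₂≡y)) ∣y∣≤W)
        (subst (λ t → ∣ t ∣ ≤ W (suc n)) (trans x≡ (sym w₁-w₂≡x)) ∣x∣≤W))

unitDigit : Sign → Sign → Digit
unitDigit Sign.+ Sign.+ = di
unitDigit Sign.+ Sign.- = d1
unitDigit Sign.- Sign.+ = dm1
unitDigit Sign.- Sign.- = dmi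

unitDigit-sum : ∀ s t → re (digit (unitDigit s t)) ℤ.+ im (digit (unitDigit s t)) ≡ s ◃ 1
unitDigit-sum Sign.+ Sign.+ = refl
unitDigit-sum Sign.+ Sign.- = refl
unitDigit-sum Sign.- Sign.+ = refl
unitDigit-sum Sign.- Sign.- = refl

unitDigit-difference : ∀ s t → im (digit (unitDigit s t)) ℤ.- re (digit (unitDigit s t)) ≡ t ◃ 1
unitDigit-difference Sign.+ Sign.+ = refl
unitDigit-difference Sign.+ Sign.- = refl
unitDigit-difference Sign.- Sign.+ = refl
unitDigit-difference Sign.- Sign.- = refl

peel-by-splits : ∀ {n z a c} → OddSplit (re z ℤ.+ im z) a → OddSplit (im z ℤ.- re z) c
               → a ≤ W n → c ≤ W n → a + c < W (suc n)
               → (∃[ t ] a ≡ suc (t + t)) ⊎ (∃[ t ] c ≡ suc (t + t)) → Peeled n z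
peel-by-splits {z = z} (oddSplit s w₁ x+y≡ refl) (oddSplit t w₂ y-x≡ refl) ∣w₁∣≤W ∣w₂∣≤W ∣w∣<W odd =
  unitDigit s t , w₁ + w₂ i , z≡ , 2∤w odd , ∣w₁∣≤W , ∣w₂∣≤W , ∣w∣<W
  where
  u = digit (unitDigit s t)
  z≡ : z ≡ u ⊕ 1+i ⊗ (w₁ + w₂ i)
  z≡ = ≡u⊕1+i⊗w z u (w₁ + w₂ i)
         (trans x+y≡ (cong (ℤ._+ (w₁ ℤ.+ w₁)) (sym (unitDigit-sum s t))))
         (trans y-x≡ (cong (ℤ._+ (w₂ ℤ.+ w₂)) (sym (unitDigit-difference s t))))
  2∤w : (∃[ r ] ∣ w₁ ∣ ≡ suc (r + r)) ⊎ (∃[ r ] ∣ w₂ ∣ ≡ suc (r + r)) → 2∤ (w₁ + w₂ i)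
  2∤w (inj₁ (r , ∣w₁∣≡)) = odd-re⇒2∤ (∣1+a+a∣⇒odd w₁ r ∣w₁∣≡)
  2∤w (inj₂ (r , ∣w₂∣≡)) = odd-im⇒2∤ (∣1+a+a∣⇒odd w₂ r ∣w₂∣≡)

-- x + y = ±1 + 2 w₁ and y − x = ±1 + 2 w₂ each allow two values of |wᵢ| (a or a + 1, c or c + 1);
-- one of them is chosen odd, which makes w₁ + w₂ i prime to 2.
mixed⇒peeled : ∀ {n z} → Odd (re z ℤ.+ im z) → Odd (im z ℤ.- re z) → Box (suc n) z → Peeled n z
mixed⇒peeled {n} {z} o₁ o₂ (∣x∣≤W , ∣y∣≤W , ∥z∥<W) with odd-splits o₁ | odd-splits o₂
... | a , ∣x+y∣≡ , short₁ , long₁ | c , ∣y-x∣≡ , short₂ , long₂ = choose (halve a) (halve c)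
  where
  half≤W : ∀ {e} b → ∣ e ∣ ≡ suc (b + b) → ∣ e ∣ ≤ ∥ z ∥₁ → b ≤ W n
  half≤W b ∣e∣≡ ∣e∣≤ = m+m<n+n+2⇒m≤n b (W n)
    (ℕ.<-trans (ℕ.n<1+n (b + b)) (ℕ.≤-<-trans (subst (_≤ ∥ z ∥₁) ∣e∣≡ ∣e∣≤) ∥z∥<W))
  a≤W : a ≤ W n
  a≤W = half≤W {re z ℤ.+ im z} a ∣x+y∣≡ (∣x+y∣≤∥z∥₁ z)
  c≤W : c ≤ W n
  c≤W = half≤W {im z ℤ.- re z} c ∣y-x∣≡ (∣y-x∣≤∥z∥₁ z)
  regroup : ∀ a c → suc (a + a) + suc (c + c) ≡ suc (a + c) + suc (a + c)
  regroup = ℕ-Ring.solve-∀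
  a+c<W : a + c < W (suc n)
  a+c<W = m+m≤n+n⇒m≤n (suc (a + c)) (W (suc n))
    (subst (_≤ W (suc n) + W (suc n))
      (trans (cong₂ _+_ (trans (cong ∣_∣ (ℤ.+-comm (im z) (re z))) ∣x+y∣≡) ∣y-x∣≡) (regroup a c))
      (∣p+q∣+∣p-q∣≤V+V (im z) (re z) (W (suc n)) ∣y∣≤W ∣x∣≤W))
  2+a+c≤W : ∀ h k → a ≡ h + h → c ≡ k + k → suc (suc (a + c)) ≤ W (suc n)
  2+a+c≤W h k a-even c-even =
    odd≤W⇒odd<W n (h + k) (cong suc (trans (cong₂ _+_ a-even c-even) (+-interchange h h k k))) a+c<W
  1+x≤W : ∀ {x y} → x ≤ y → suc (suc (x + y)) ≤ W (suc n) → suc x ≤ W n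
  1+x≤W {x} x≤y 2+x+y≤W = m+m≤n+n⇒m≤n (suc x) (W n)
    (ℕ.≤-trans (s≤s (ℕ.≤-trans (ℕ.≤-reflexive (ℕ.+-suc x x)) (s≤s (ℕ.+-monoʳ-≤ x x≤y))))
               (ℕ.≤-trans 2+x+y≤W (W-suc≤W+W n)))
  choose : ∃[ h ] (a ≡ h + h ⊎ a ≡ suc (h + h)) → ∃[ k ] (c ≡ k + k ⊎ c ≡ suc (k + k)) → Peeled n z
  choose (h , inj₂ a-odd) _ = peel-by-splits {n} short₁ short₂ a≤W c≤W a+c<W (inj₁ (h , a-odd))
  choose (h , inj₁ _) (k , inj₂ c-odd) = peel-by-splits {n} short₁ short₂ a≤W c≤W a+c<W (inj₂ (k , c-odd))
  choose (h , inj₁ a-even) (k , inj₁ c-even) with ℕ.≤-total a c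
  ... | inj₁ a≤c = peel-by-splits {n} long₁ short₂ (1+x≤W a≤c (2+a+c≤W h k a-even c-even)) c≤W
                     (2+a+c≤W h k a-even c-even) (inj₁ (h , cong suc a-even))
  ... | inj₂ c≤a = peel-by-splits {n} short₁ long₂ a≤W (1+x≤W c≤a 2+c+a≤W)
                     (subst (λ t → suc t ≤ W (suc n)) (sym (ℕ.+-suc a c)) (2+a+c≤W h k a-even c-even))
                     (inj₂ (k , cong suc c-even))
    where
    2+c+a≤W : suc (suc (c + a)) ≤ W (suc n)
    2+c+a≤W = subst (λ t → suc (suc t) ≤ W (suc n)) (ℕ.+-comm a c) (2+a+c≤W h k a-even c-even)

2∤⇒peeled : ∀ {n z} → 2∤ z → Box (suc n) z → Peeled n z
2∤⇒peeled {n} 2∤z box with 2∤⇒oddParts 2∤z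
... | odd-odd  o₁ o₂ = odd-odd⇒peeled {n} o₁ o₂ box
... | odd-even o₁ e₂ = mixed⇒peeled {n} (odd+even o₁ e₂) (even+odd e₂ (neg-odd o₁)) box
... | even-odd e₁ o₂ = mixed⇒peeled {n} (even+odd e₁ o₂) (odd+even o₂ (neg-even e₁)) box

box⇒expansion : ∀ n z → 2∤ z → Box n z → ShortExpansion n z
box⇒expansion zero z 2∤z box = box-0⇒expansion z 2∤z box
box⇒expansion (suc n) z 2∤z box with 2∤⇒peeled {n} 2∤z box
... | d , w , z≡ , 2∤w , box′ = peel d z≡ (box⇒expansion n w 2∤w box′)

-- Boxes containing the points with an expansion

1+2^k*a≤W : ∀ k n {a} → a < W n → suc (2 ^ k * a) ≤ W (2 * k + n)
1+2^k*a≤W k n {a} a<W = begin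
  suc (2 ^ k * a)     ≤⟨ ℕ.+-monoˡ-≤ (2 ^ k * a) (ℕ.m^n>0 2 k) ⟩
  2 ^ k + 2 ^ k * a   ≡⟨ sym (ℕ.*-suc (2 ^ k) a) ⟩
  2 ^ k * suc a       ≤⟨ ℕ.*-monoʳ-≤ (2 ^ k) a<W ⟩
  2 ^ k * W n         ≤⟨ 2^k*W≤W k n ⟩
  W (2 * k + n)       ∎
  where open ℕ.≤-Reasoning

2+2^k*[W+W]≤W : ∀ k M → suc (suc (2 ^ k * (W M + W M))) ≤ W (2 * k + suc (suc M))
2+2^k*[W+W]≤W k M = begin
  2 + 2 ^ k * (W M + W M)          ≤⟨ ℕ.+-monoˡ-≤ (2 ^ k * (W M + W M)) (ℕ.m≤n*m 2 (2 ^ k) {{ℕ.m^n≢0 2 k}}) ⟩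
  2 ^ k * 2 + 2 ^ k * (W M + W M)  ≡⟨ regroup (2 ^ k) (W M) ⟩
  2 ^ k * W (suc (suc M))          ≤⟨ 2^k*W≤W k (suc (suc M)) ⟩
  W (2 * k + suc (suc M))          ∎
  where
  open ℕ.≤-Reasoning
  regroup : ∀ p w → p * 2 + p * (w + w) ≡ p * (w + w + 2)
  regroup = ℕ-Ring.solve-∀

d0? : ∀ d → Dec (d ≡ d0)
d0? d0  = yes refl
d0? d1  = no λ ()
d0? dm1 = no λ ()
d0? di  = no λ ()
d0? dmi = no λ ()

∥digit∥₁≡1 : ∀ {d} → d ≢ d0 → ∥ digit d ∥₁ ≡ 1
∥digit∥₁≡1 {d0}  d≢0 = ⊥-elim (d≢0 refl)
∥digit∥₁≡1 {d1}  _ = refl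
∥digit∥₁≡1 {dm1} _ = refl
∥digit∥₁≡1 {di}  _ = refl
∥digit∥₁≡1 {dmi} _ = refl

digit-odd : ∀ {d} → d ≢ d0 → Odd (re (digit d) ℤ.+ im (digit d))
digit-odd {d0}  d≢0 = ⊥-elim (d≢0 refl)
digit-odd {d1}  _ = + 0 , refl
digit-odd {dm1} _ = -[1+ 0 ] , refl
digit-odd {di}  _ = + 0 , refl
digit-odd {dmi} _ = -[1+ 0 ] , refl

∣re-digit∣≤1 : ∀ {d} → d ≢ d0 → ∣ re (digit d) ∣ ≤ 1
∣re-digit∣≤1 {d} d≢0 = subst (∣ re (digit d) ∣ ≤_) (∥digit∥₁≡1 d≢0) (ℕ.m≤m+n ∣ re (digit d) ∣ ∣ im (digit d) ∣)

∣im-digit∣≤1 : ∀ {d} → d ≢ d0 → ∣ im (digit d) ∣ ≤ 1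
∣im-digit∣≤1 {d} d≢0 = subst (∣ im (digit d) ∣ ≤_) (∥digit∥₁≡1 d≢0) (ℕ.m≤n+m ∣ im (digit d) ∣ ∣ re (digit d) ∣)

unit-box : ∀ {d} → d ≢ d0 → ∀ n → Box n (digit d)
unit-box {d} d≢0 n = ℕ.≤-trans (∣re-digit∣≤1 d≢0) 1≤W , ℕ.≤-trans (∣im-digit∣≤1 d≢0) 1≤W
                   , subst (_< W (suc n)) (sym (∥digit∥₁≡1 d≢0)) 2≤W
  where
  1≤W : 1 ≤ W n
  1≤W = ℕ.≤-trans (s≤s z≤n) (n<W n)
  2≤W : 2 ≤ W (suc n)
  2≤W = ℕ.≤-trans (s≤s (s≤s z≤n)) (n<W (suc n))

re+im-u⊕1+i⊗t : ∀ u t → re (u ⊕ 1+i ⊗ t) ℤ.+ im (u ⊕ 1+i ⊗ t) ≡ (re u ℤ.+ im u) ℤ.+ (re t ℤ.+ re t)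
re+im-u⊕1+i⊗t (u₁ + u₂ i) (t₁ + t₂ i) = regroup u₁ u₂ t₁ t₂
  where
  regroup : ∀ u₁ u₂ t₁ t₂ → (u₁ ℤ.+ (+ 1 ℤ.* t₁ ℤ.- + 1 ℤ.* t₂)) ℤ.+ (u₂ ℤ.+ (+ 1 ℤ.* t₂ ℤ.+ + 1 ℤ.* t₁))
                          ≡ (u₁ ℤ.+ u₂) ℤ.+ (t₁ ℤ.+ t₁)
  regroup = ℤ-Ring.solve-∀

digit⊕1+i⊗t-2∤ : ∀ {d} → d ≢ d0 → ∀ t → 2∤ (digit d ⊕ 1+i ⊗ t)
digit⊕1+i⊗t-2∤ {d} d≢0 t = odd-re+im⇒2∤
  (subst Odd (sym (re+im-u⊕1+i⊗t (digit d) t)) (odd+even (digit-odd d≢0) (re t , refl)))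

digit⊕1+i⊗T-bounds : ∀ {d} → d ≢ d0 → ∀ T → let z = digit d ⊕ 1+i ⊗ T in
                       ∣ re z ∣ ≤ suc ∥ T ∥₁ × ∣ im z ∣ ≤ suc ∥ T ∥₁
                     × ∥ z ∥₁ ≤ suc (∣ re T ℤ.+ im T ∣ + ∣ re T ℤ.- im T ∣)
digit⊕1+i⊗T-bounds {d} d≢0 T =
    subst (_≤ suc ∥ T ∥₁) (sym (cong ∣_∣ z₁≡)) (∣u+v∣≤ {re u} {re T ℤ.- im T} (∣re-digit∣≤1 d≢0) (ℤ.∣i-j∣≤∣i∣+∣j∣ (re T) (im T)))
  , subst (_≤ suc ∥ T ∥₁) (sym (cong ∣_∣ z₂≡)) (∣u+v∣≤ {im u} {re T ℤ.+ im T} (∣im-digit∣≤1 d≢0) (ℤ.∣i+j∣≤∣i∣+∣j∣ (re T) (im T)))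
  , ∥z∥≤
  where
  u = digit d
  z₁≡ : re (u ⊕ 1+i ⊗ T) ≡ re u ℤ.+ (re T ℤ.- im T)
  z₁≡ = cong (λ s → re u ℤ.+ re s) (1+i⊗z≡ T)
  z₂≡ : im (u ⊕ 1+i ⊗ T) ≡ im u ℤ.+ (re T ℤ.+ im T)
  z₂≡ = cong (λ s → im u ℤ.+ im s) (1+i⊗z≡ T)
  ∣u+v∣≤ : ∀ {a v} → ∣ a ∣ ≤ 1 → ∣ v ∣ ≤ ∥ T ∥₁ → ∣ a ℤ.+ v ∣ ≤ suc ∥ T ∥₁
  ∣u+v∣≤ {a} {v} ∣a∣≤1 ∣v∣≤ = ℕ.≤-trans (ℤ.∣i+j∣≤∣i∣+∣j∣ a v) (ℕ.+-mono-≤ ∣a∣≤1 ∣v∣≤)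
  ∥z∥≤ : ∥ u ⊕ 1+i ⊗ T ∥₁ ≤ suc (∣ re T ℤ.+ im T ∣ + ∣ re T ℤ.- im T ∣)
  ∥z∥≤ = begin
    ∥ u ⊕ 1+i ⊗ T ∥₁                                            ≡⟨ cong₂ _+_ (cong ∣_∣ z₁≡) (cong ∣_∣ z₂≡) ⟩
    ∣ re u ℤ.+ (re T ℤ.- im T) ∣ + ∣ im u ℤ.+ (re T ℤ.+ im T) ∣  ≤⟨ ℕ.+-mono-≤ (ℤ.∣i+j∣≤∣i∣+∣j∣ (re u) _) (ℤ.∣i+j∣≤∣i∣+∣j∣ (im u) _) ⟩
    (∣ re u ∣ + ∣ re T ℤ.- im T ∣) + (∣ im u ∣ + ∣ re T ℤ.+ im T ∣) ≡⟨ +-interchange (∣ re u ∣) _ (∣ im u ∣) _ ⟩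
    ∥ u ∥₁ + (∣ re T ℤ.- im T ∣ + ∣ re T ℤ.+ im T ∣)             ≡⟨ cong₂ _+_ (∥digit∥₁≡1 d≢0) (ℕ.+-comm ∣ re T ℤ.- im T ∣ _) ⟩
    suc (∣ re T ℤ.+ im T ∣ + ∣ re T ℤ.- im T ∣)                  ∎
    where open ℕ.≤-Reasoning

digit⊕1+i⊗2^k⊗t-box : ∀ {d} → d ≢ d0 → ∀ k M t → Box M t
                     → Box (suc (2 * k + M)) (digit d ⊕ 1+i ⊗ ((2g ^g k) ⊗ t))
digit⊕1+i⊗2^k⊗t-box d≢0 k M t (∣t₁∣≤W , ∣t₂∣≤W , ∥t∥<W) with digit⊕1+i⊗T-bounds d≢0 T
  where T = (2g ^g k) ⊗ t
... | ∣z₁∣≤ , ∣z₂∣≤ , ∥z∥≤ = ℕ.≤-trans ∣z₁∣≤ 1+∥T∥≤W , ℕ.≤-trans ∣z₂∣≤ 1+∥T∥≤W , ℕ.≤-<-trans ∥z∥≤ 1+∣T₁±T₂∣<W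
  where
  P = 2 ^ k
  T = (2g ^g k) ⊗ t
  ∣T₁∣≡ : ∣ re T ∣ ≡ P * ∣ re t ∣
  ∣T₁∣≡ = trans (cong (∣_∣ ∘ re) (2g^k⊗z≡ k t)) (ℤ.abs-* (+ P) (re t))
  ∣T₂∣≡ : ∣ im T ∣ ≡ P * ∣ im t ∣
  ∣T₂∣≡ = trans (cong (∣_∣ ∘ im) (2g^k⊗z≡ k t)) (ℤ.abs-* (+ P) (im t))
  1+∥T∥≤W : suc ∥ T ∥₁ ≤ W (suc (2 * k + M))
  1+∥T∥≤W = subst₂ (λ a b → suc a ≤ W b)
    (trans (ℕ.*-distribˡ-+ P ∣ re t ∣ ∣ im t ∣) (sym (cong₂ _+_ ∣T₁∣≡ ∣T₂∣≡))) (ℕ.+-suc (2 * k) M)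
    (1+2^k*a≤W k (suc M) ∥t∥<W)
  1+∣T₁±T₂∣<W : suc (∣ re T ℤ.+ im T ∣ + ∣ re T ℤ.- im T ∣) < W (suc (suc (2 * k + M)))
  1+∣T₁±T₂∣<W = subst (λ n → suc (∣ re T ℤ.+ im T ∣ + ∣ re T ℤ.- im T ∣) < W n)
    (trans (ℕ.+-suc (2 * k) (suc M)) (cong suc (ℕ.+-suc (2 * k) M)))
    (ℕ.<-≤-trans (s≤s (s≤s (subst (∣ re T ℤ.+ im T ∣ + ∣ re T ℤ.- im T ∣ ≤_)
        (sym (ℕ.*-distribˡ-+ P (W M) (W M)))
        (∣p+q∣+∣p-q∣≤V+V (re T) (im T) (P * W M)
          (subst (_≤ P * W M) (sym ∣T₁∣≡) (ℕ.*-monoʳ-≤ P ∣t₁∣≤W))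
          (subst (_≤ P * W M) (sym ∣T₂∣≡) (ℕ.*-monoʳ-≤ P ∣t₂∣≤W))))))
      (2+2^k*[W+W]≤W k M))

1+i⊗-box : ∀ {M t} → Box M t → Box (suc M) (1+i ⊗ t)
1+i⊗-box {M} {t} (∣t₁∣≤W , ∣t₂∣≤W , ∥t∥<W) = subst (Box (suc M)) (sym (1+i⊗z≡ t))
  ( ℕ.≤-trans (ℤ.∣i-j∣≤∣i∣+∣j∣ (re t) (im t)) (ℕ.<⇒≤ ∥t∥<W)
  , ℕ.≤-trans (ℤ.∣i+j∣≤∣i∣+∣j∣ (re t) (im t)) (ℕ.<⇒≤ ∥t∥<W)
  , ℕ.<-≤-trans (s≤s (subst (_≤ W M + W M) (ℕ.+-comm ∣ re t ℤ.+ im t ∣ _)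
                        (∣p+q∣+∣p-q∣≤V+V (re t) (im t) (W M) ∣t₁∣≤W ∣t₂∣≤W)))
                 (subst (suc (W M + W M) ≤_) (ℕ.+-comm 2 (W M + W M)) (ℕ.n≤1+n _)))

1+i⊗-box⁻¹ : ∀ {M y} → Odd (re y ℤ.+ im y) → Box (suc M) (1+i ⊗ y) → Box M y
1+i⊗-box⁻¹ {M} {y@(y₁ + y₂ i)} odd box with subst (Box (suc M)) (1+i⊗z≡ y) box
... | ∣y₁-y₂∣≤W , ∣y₁+y₂∣≤W , ∥s∥<W = ∣y₁∣≤W , ∣y₂∣≤W , ∥y∥<W
  where
  sum : (y₁ ℤ.+ y₂) ℤ.+ (y₁ ℤ.- y₂) ≡ y₁ ℤ.+ y₁
  sum = ℤ-Ring.solve (y₁ ∷ y₂ ∷ [])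
  difference : (y₁ ℤ.+ y₂) ℤ.- (y₁ ℤ.- y₂) ≡ y₂ ℤ.+ y₂
  difference = ℤ-Ring.solve (y₁ ∷ y₂ ∷ [])
  ∣s∣ = ∣ y₁ ℤ.+ y₂ ∣ + ∣ y₁ ℤ.- y₂ ∣
  ∣s∣<W : ∣s∣ < W M + W M + 2
  ∣s∣<W = subst (_< W M + W M + 2) (ℕ.+-comm ∣ y₁ ℤ.- y₂ ∣ _) ∥s∥<W
  ∣y₁∣≤W : ∣ y₁ ∣ ≤ W M
  ∣y₁∣≤W = m+m<n+n+2⇒m≤n ∣ y₁ ∣ (W M) (ℕ.≤-<-trans (subst (_≤ ∣s∣) (trans (cong ∣_∣ sum) (∣p+p∣≡∣p∣+∣p∣ y₁))
             (ℤ.∣i+j∣≤∣i∣+∣j∣ (y₁ ℤ.+ y₂) (y₁ ℤ.- y₂))) ∣s∣<W)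
  ∣y₂∣≤W : ∣ y₂ ∣ ≤ W M
  ∣y₂∣≤W = m+m<n+n+2⇒m≤n ∣ y₂ ∣ (W M) (ℕ.≤-<-trans (subst (_≤ ∣s∣) (trans (cong ∣_∣ difference) (∣p+p∣≡∣p∣+∣p∣ y₂))
             (ℤ.∣i-j∣≤∣i∣+∣j∣ (y₁ ℤ.+ y₂) (y₁ ℤ.- y₂))) ∣s∣<W)
  ∥y∥<W : ∥ y ∥₁ < W (suc M)
  ∥y∥<W with odd⇒∣m∣+∣n∣-odd y₁ y₂ odd
  ... | t , ∥y∥≡ = odd≤W⇒odd<W M t ∥y∥≡ (∣p±q∣≤V⇒∣p∣+∣q∣≤V y₁ y₂ (W (suc M)) ∣y₁+y₂∣≤W ∣y₁-y₂∣≤W)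

ig⊗-box : ∀ {M y} → Box M y → Box M (ig ⊗ y)
ig⊗-box {M} {y₁ + y₂ i} (∣y₁∣≤W , ∣y₂∣≤W , ∥y∥<W) = subst (Box M) (sym ig⊗y≡)
  (subst (_≤ W M) (sym (ℤ.∣-i∣≡∣i∣ y₂)) ∣y₂∣≤W , ∣y₁∣≤W ,
   subst (_< W (suc M)) (trans (ℕ.+-comm ∣ y₁ ∣ ∣ y₂ ∣) (cong (_+ ∣ y₁ ∣) (sym (ℤ.∣-i∣≡∣i∣ y₂)))) ∥y∥<W)
  where
  ig⊗y≡ : ig ⊗ (y₁ + y₂ i) ≡ (ℤ.- y₂) + y₁ i
  ig⊗y≡ = cong₂ _+_i (ℤ-Ring.solve (y₁ ∷ y₂ ∷ [])) (ℤ-Ring.solve (y₁ ∷ y₂ ∷ []))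

odd-odd-¬box-0 : ∀ {t} → Odd (re t) → Odd (im t) → ¬ Box 0 t
odd-odd-¬box-0 o₁ o₂ (_ , _ , ∥t∥<2) with ∣odd∣ o₁ | ∣odd∣ o₂
... | a , ∣t₁∣≡ | b , ∣t₂∣≡ = ℕ.<⇒≱ ∥t∥<2 (subst (2 ≤_) (sym (cong₂ _+_ ∣t₁∣≡ ∣t₂∣≡))
  (s≤s (ℕ.≤-trans (s≤s z≤n) (ℕ.m≤n+m (suc (b + b)) (a + a)))))

even-re+im⇒1+i∣ : ∀ {t} → Even (re t ℤ.+ im t) → ∃[ y ] t ≡ 1+i ⊗ y
even-re+im⇒1+i∣ {t₁ + t₂ i} (h , t₁+t₂≡) = h + (h ℤ.- t₁) i , sym (trans (1+i⊗z≡ (h + (h ℤ.- t₁) i))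
  (cong₂ _+_i (halve-re t₁ h) (trans (halve-im t₁ h) (trans (cong (ℤ._- t₁) (sym t₁+t₂≡)) (cancel t₁ t₂)))))
  where
  halve-re : ∀ t₁ h → h ℤ.- (h ℤ.- t₁) ≡ t₁
  halve-re = ℤ-Ring.solve-∀
  halve-im : ∀ t₁ h → h ℤ.+ (h ℤ.- t₁) ≡ (h ℤ.+ h) ℤ.- t₁
  halve-im = ℤ-Ring.solve-∀
  cancel : ∀ t₁ t₂ → (t₁ ℤ.+ t₂) ℤ.- t₁ ≡ t₂
  cancel = ℤ-Ring.solve-∀

record BoxedOddPart (m : ℕ) (z : ℤ[i]) : Set where
  constructor boxed
  field
    k M    : ℕ
    odd    : ℤ[i]
    factor : z ≡ (2g ^g k) ⊗ odd
    2∤odd  : 2∤ odd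
    length : m ≡ 2 * k + M
    box    : Box M odd

ZeroOrBoxed : ℕ → ℤ[i] → Set
ZeroOrBoxed m z = z ≡ 0g ⊎ BoxedOddPart m z

re+im-ig⊗y : ∀ y → re (ig ⊗ y) ℤ.+ im (ig ⊗ y) ≡ re (1+i ⊗ y)
re+im-ig⊗y (y₁ + y₂ i) = regroup y₁ y₂
  where
  regroup : ∀ y₁ y₂ → (+ 0 ℤ.* y₁ ℤ.- + 1 ℤ.* y₂) ℤ.+ (+ 0 ℤ.* y₂ ℤ.+ + 1 ℤ.* y₁) ≡ + 1 ℤ.* y₁ ℤ.- + 1 ℤ.* y₂
  regroup = ℤ-Ring.solve-∀

1+i⊗-boxed : ∀ {m t} → BoxedOddPart m t → BoxedOddPart (suc m) (1+i ⊗ t)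
1+i⊗-boxed {m} {t} (boxed k M t′ t≡ 2∤t′ m≡ box) with even⊎odd (re t′ ℤ.+ im t′)
... | inj₂ odd = boxed k (suc M) (1+i ⊗ t′) (trans (cong (1+i ⊗_) t≡) (⊗-swap 1+i (2g ^g k) t′))
                   (odd-im⇒2∤ (subst Odd (sym (cong im (1+i⊗z≡ t′))) odd))
                   (trans (cong suc m≡) (sym (ℕ.+-suc (2 * k) M))) (1+i⊗-box {M} {t′} box)
... | inj₁ even with even-re+im⇒1+i∣ even | 2∤⇒oddParts 2∤t′
...   | _ , _    | odd-even o₁ e₂ = ⊥-elim (even⇒¬odd even (odd+even o₁ e₂))
...   | _ , _    | even-odd e₁ o₂ = ⊥-elim (even⇒¬odd even (even+odd e₁ o₂))
...   | y , t′≡ | odd-odd o₁ o₂ = shrink M m≡ (subst (Box M) t′≡ box)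
  where
  open ≡-Reasoning
  -- (1+i)² = 2i, so one more factor 2 splits off
  1+i⊗t≡ : 1+i ⊗ t ≡ (2g ^g suc k) ⊗ (ig ⊗ y)
  1+i⊗t≡ = begin
    1+i ⊗ t                              ≡⟨ cong (1+i ⊗_) t≡ ⟩
    1+i ⊗ ((2g ^g k) ⊗ t′)              ≡⟨ cong (λ s → 1+i ⊗ ((2g ^g k) ⊗ s)) t′≡ ⟩
    1+i ⊗ ((2g ^g k) ⊗ (1+i ⊗ y))        ≡⟨ ⊗-swap 1+i (2g ^g k) (1+i ⊗ y) ⟩
    (2g ^g k) ⊗ (1+i ⊗ (1+i ⊗ y))        ≡⟨ cong ((2g ^g k) ⊗_) (⊗-assoc 1+i 1+i y) ⟩
    (2g ^g k) ⊗ ((2g ⊗ ig) ⊗ y)          ≡⟨ cong ((2g ^g k) ⊗_) (sym (⊗-assoc 2g ig y)) ⟩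
    (2g ^g k) ⊗ (2g ⊗ (ig ⊗ y))          ≡⟨ ⊗-swap (2g ^g k) 2g (ig ⊗ y) ⟩
    2g ⊗ ((2g ^g k) ⊗ (ig ⊗ y))          ≡⟨ ⊗-assoc 2g (2g ^g k) (ig ⊗ y) ⟩
    (2g ^g suc k) ⊗ (ig ⊗ y)             ∎
  2∤iy : 2∤ (ig ⊗ y)
  2∤iy = odd-re+im⇒2∤ (subst Odd (sym (re+im-ig⊗y y)) (subst (Odd ∘ re) t′≡ o₁))
  odd-y : Odd (re y ℤ.+ im y)
  odd-y = subst Odd (cong im (1+i⊗z≡ y)) (subst (Odd ∘ im) t′≡ o₂)
  shrink : ∀ M → m ≡ 2 * k + M → Box M (1+i ⊗ y) → BoxedOddPart (suc m) (1+i ⊗ t)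
  shrink zero _ box = ⊥-elim (odd-odd-¬box-0 o₁ o₂ (subst (Box 0) (sym t′≡) box))
  shrink (suc M′) m≡ box = boxed (suc k) M′ (ig ⊗ y) 1+i⊗t≡ 2∤iy
    (trans (cong suc m≡) (index k M′)) (ig⊗-box {M′} {y} (1+i⊗-box⁻¹ {M′} {y} odd-y box))
    where
    index : ∀ k M → suc (2 * k + suc M) ≡ 2 * suc k + M
    index = ℕ-Ring.solve-∀

digit⊕1+i⊗-boxed : ∀ {m t d} → d ≢ d0 → ZeroOrBoxed m t → BoxedOddPart (suc m) (digit d ⊕ 1+i ⊗ t)
digit⊕1+i⊗-boxed {m} {t} {d} d≢0 t-info =
  boxed 0 (suc m) (digit d ⊕ 1+i ⊗ t) (sym (⊗-identityˡ _)) (digit⊕1+i⊗t-2∤ d≢0 t) refl (box t-info)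
  where
  box : ZeroOrBoxed m t → Box (suc m) (digit d ⊕ 1+i ⊗ t)
  box (inj₁ refl) = subst (Box (suc m)) (sym (⊕-identityʳ (digit d))) (unit-box d≢0 (suc m))
  box (inj₂ (boxed k M t′ refl _ refl box′)) = digit⊕1+i⊗2^k⊗t-box d≢0 k M t′ box′

digit-boxed : ∀ d → ZeroOrBoxed 0 (digit d)
digit-boxed d with d0? d
... | yes refl = inj₁ refl
... | no d≢0   = inj₂ (boxed 0 0 (digit d) (sym (⊗-identityˡ (digit d))) (odd-re+im⇒2∤ (digit-odd d≢0)) refl
                             (unit-box d≢0 0))

∷-boxed : ∀ {m t} d → ZeroOrBoxed m t → ZeroOrBoxed (suc m) (digit d ⊕ 1+i ⊗ t)
∷-boxed d t-info with d0? d
∷-boxed d (inj₁ refl) | yes refl = inj₁ refl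
∷-boxed d (inj₂ b)    | yes refl = inj₂ (subst (BoxedOddPart _) (sym (⊕-identityˡ _)) (1+i⊗-boxed b))
∷-boxed d t-info      | no d≢0   = inj₂ (digit⊕1+i⊗-boxed d≢0 t-info)

expansion-boxed : ∀ m u → ZeroOrBoxed m (value m u)
expansion-boxed zero u = subst (ZeroOrBoxed 0) (sym (value-zero u)) (digit-boxed (u Fin.zero))
expansion-boxed (suc m) u = subst (ZeroOrBoxed (suc m)) (sym (value-suc m u))
  (∷-boxed (u Fin.zero) (expansion-boxed m (u ∘ Fin.suc)))

expansion⇒box : ∀ {z m} → HasExpansion z m → ∀ k {z′} → z ≡ (2g ^g k) ⊗ z′ → 2∤ z′
              → ∃[ M ] m ≡ 2 * k + M × Box M z′
expansion⇒box {m = m} (u , _ , z≡) k {z′} z≡2^kz′ 2∤z′ with expansion-boxed m u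
... | inj₁ z≡0 = ⊥-elim (2∤⇒≢0 2∤z′ (2g^k⊗-cancel k
        (trans (sym z≡2^kz′) (trans z≡ (trans z≡0 (sym (⊗-zeroʳ (2g ^g k))))))))
... | inj₂ (boxed k′ M t′ z≡2^k′t′ 2∤t′ m≡ box)
  with oddPart-unique k k′ (trans (sym z≡2^kz′) (trans z≡ z≡2^k′t′)) 2∤z′ 2∤t′
...   | refl , refl = M , m≡ , box

-- Remainder bounds

RemainderBound : ℕ → ℤ[i] → ℤ[i] → Set
RemainderBound c r b = ∣ re (r ⊗ conj b) ∣ + ∣ re (r ⊗ conj b) ∣ ≤ c
                     × ∣ im (r ⊗ conj b) ∣ + ∣ im (r ⊗ conj b) ∣ ≤ c

2N∣R∣≤c[∣p∣+∣q∣] : ∀ {N R c} X Y p q → + N ℤ.* R ≡ X ℤ.* p ℤ.+ Y ℤ.* q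
                 → ∣ X ∣ + ∣ X ∣ ≤ c → ∣ Y ∣ + ∣ Y ∣ ≤ c → N * ∣ R ∣ + N * ∣ R ∣ ≤ c * (∣ p ∣ + ∣ q ∣)
2N∣R∣≤c[∣p∣+∣q∣] {N} {R} {c} X Y p q NR≡ 2∣X∣≤c 2∣Y∣≤c = begin
  N * ∣ R ∣ + N * ∣ R ∣                                     ≤⟨ ℕ.+-mono-≤ N∣R∣≤ N∣R∣≤ ⟩
  (∣ X ∣ * ∣ p ∣ + ∣ Y ∣ * ∣ q ∣) + (∣ X ∣ * ∣ p ∣ + ∣ Y ∣ * ∣ q ∣) ≡⟨ regroup (∣ X ∣) (∣ p ∣) (∣ Y ∣) (∣ q ∣) ⟩
  (∣ X ∣ + ∣ X ∣) * ∣ p ∣ + (∣ Y ∣ + ∣ Y ∣) * ∣ q ∣          ≤⟨ ℕ.+-mono-≤ (ℕ.*-monoˡ-≤ (∣ p ∣) 2∣X∣≤c) (ℕ.*-monoˡ-≤ (∣ q ∣) 2∣Y∣≤c) ⟩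
  c * ∣ p ∣ + c * ∣ q ∣                                     ≡⟨ sym (ℕ.*-distribˡ-+ c (∣ p ∣) (∣ q ∣)) ⟩
  c * (∣ p ∣ + ∣ q ∣)                                       ∎
  where
  open ℕ.≤-Reasoning
  N∣R∣≤ : N * ∣ R ∣ ≤ ∣ X ∣ * ∣ p ∣ + ∣ Y ∣ * ∣ q ∣
  N∣R∣≤ = subst₂ _≤_ (trans (cong ∣_∣ (sym NR≡)) (ℤ.abs-* (+ N) R)) (cong₂ _+_ (ℤ.abs-* X p) (ℤ.abs-* Y q))
            (ℤ.∣i+j∣≤∣i∣+∣j∣ (X ℤ.* p) (Y ℤ.* q))
  regroup : ∀ x p y q → (x * p + y * q) + (x * p + y * q) ≡ (x + x) * p + (y + y) * q
  regroup = ℕ-Ring.solve-∀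

2N∣r₁∣≤c∥b∥₁ : ∀ {c} r b → RemainderBound c r b → Nm b * ∣ re r ∣ + Nm b * ∣ re r ∣ ≤ c * ∥ b ∥₁
2N∣r₁∣≤c∥b∥₁ {c} (r₁ + r₂ i) b@(b₁ + b₂ i) (2∣X∣≤c , 2∣Y∣≤c) =
  subst (λ x → Nm b * ∣ r₁ ∣ + Nm b * ∣ r₁ ∣ ≤ c * (∣ b₁ ∣ + x)) (ℤ.∣-i∣≡∣i∣ b₂)
    (2N∣R∣≤c[∣p∣+∣q∣] {Nm b} X Y b₁ (ℤ.- b₂) (trans (cong (ℤ._* r₁) (+Nm≡ b)) (identity r₁ r₂ b₁ b₂)) 2∣X∣≤c 2∣Y∣≤c)
  where
  X = re ((r₁ + r₂ i) ⊗ conj b)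
  Y = im ((r₁ + r₂ i) ⊗ conj b)
  identity : ∀ r₁ r₂ b₁ b₂ → (b₁ ℤ.* b₁ ℤ.+ b₂ ℤ.* b₂) ℤ.* r₁
           ≡ (r₁ ℤ.* b₁ ℤ.- r₂ ℤ.* (ℤ.- b₂)) ℤ.* b₁ ℤ.+ (r₁ ℤ.* (ℤ.- b₂) ℤ.+ r₂ ℤ.* b₁) ℤ.* (ℤ.- b₂)
  identity = ℤ-Ring.solve-∀

2N∣r₂∣≤c∥b∥₁ : ∀ {c} r b → RemainderBound c r b → Nm b * ∣ im r ∣ + Nm b * ∣ im r ∣ ≤ c * ∥ b ∥₁
2N∣r₂∣≤c∥b∥₁ {c} (r₁ + r₂ i) b@(b₁ + b₂ i) (2∣X∣≤c , 2∣Y∣≤c) =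
  subst (λ x → Nm b * ∣ r₂ ∣ + Nm b * ∣ r₂ ∣ ≤ c * x) (ℕ.+-comm ∣ b₂ ∣ ∣ b₁ ∣)
    (2N∣R∣≤c[∣p∣+∣q∣] {Nm b} X Y b₂ b₁ (trans (cong (ℤ._* r₂) (+Nm≡ b)) (identity r₁ r₂ b₁ b₂)) 2∣X∣≤c 2∣Y∣≤c)
  where
  X = re ((r₁ + r₂ i) ⊗ conj b)
  Y = im ((r₁ + r₂ i) ⊗ conj b)
  identity : ∀ r₁ r₂ b₁ b₂ → (b₁ ℤ.* b₁ ℤ.+ b₂ ℤ.* b₂) ℤ.* r₂
           ≡ (r₁ ℤ.* b₁ ℤ.- r₂ ℤ.* (ℤ.- b₂)) ℤ.* b₂ ℤ.+ (r₁ ℤ.* (ℤ.- b₂) ℤ.+ r₂ ℤ.* b₁) ℤ.* b₁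
  identity = ℤ-Ring.solve-∀

N∥r∥₁≤cV : ∀ {c} r b V → RemainderBound c r b → ∣ re b ∣ ≤ V → ∣ im b ∣ ≤ V → Nm b * ∥ r ∥₁ ≤ c * V
N∥r∥₁≤cV {c} r@(r₁ + r₂ i) b@(b₁ + b₂ i) V (2∣X∣≤c , 2∣Y∣≤c) ∣b₁∣≤V ∣b₂∣≤V =
  subst (_≤ c * V) (trans (cong₂ _+_ (ℤ.abs-* (+ N) r₁) (ℤ.abs-* (+ N) r₂)) (sym (ℕ.*-distribˡ-+ N ∣ r₁ ∣ ∣ r₂ ∣)))
    (∣p±q∣≤V⇒∣p∣+∣q∣≤V (+ N ℤ.* r₁) (+ N ℤ.* r₂) (c * V)
      (subst (_≤ c * V) (sym (trans (cong ∣_∣ (sym (ℤ.*-distribˡ-+ (+ N) r₁ r₂))) (ℤ.abs-* (+ N) (r₁ ℤ.+ r₂)))) N∣r₁+r₂∣≤cV)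
      (subst (_≤ c * V) (sym (trans (cong ∣_∣ (sym (*-distribˡ-- (+ N) r₁ r₂))) (ℤ.abs-* (+ N) (r₁ ℤ.- r₂)))) N∣r₁-r₂∣≤cV))
  where
  N = Nm b
  X = re (r ⊗ conj b)
  Y = im (r ⊗ conj b)
  *-distribˡ-- : ∀ n x y → n ℤ.* (x ℤ.- y) ≡ n ℤ.* x ℤ.- n ℤ.* y
  *-distribˡ-- = ℤ-Ring.solve-∀
  ∣b₁±b₂∣≤V+V : ∣ b₁ ℤ.+ b₂ ∣ + ∣ b₁ ℤ.- b₂ ∣ ≤ V + V
  ∣b₁±b₂∣≤V+V = ∣p+q∣+∣p-q∣≤V+V b₁ b₂ V ∣b₁∣≤V ∣b₂∣≤V
  halve-bound : ∀ R → N * ∣ R ∣ + N * ∣ R ∣ ≤ c * (∣ b₁ ℤ.+ b₂ ∣ + ∣ b₁ ℤ.- b₂ ∣) → N * ∣ R ∣ ≤ c * V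
  halve-bound R h = m+m≤n+n⇒m≤n _ _
    (ℕ.≤-trans h (ℕ.≤-trans (ℕ.*-monoʳ-≤ c ∣b₁±b₂∣≤V+V) (ℕ.≤-reflexive (ℕ.*-distribˡ-+ c V V))))
  sum : ∀ r₁ r₂ b₁ b₂ → (b₁ ℤ.* b₁ ℤ.+ b₂ ℤ.* b₂) ℤ.* (r₁ ℤ.+ r₂)
      ≡ (r₁ ℤ.* b₁ ℤ.- r₂ ℤ.* (ℤ.- b₂)) ℤ.* (b₁ ℤ.+ b₂) ℤ.+ (r₁ ℤ.* (ℤ.- b₂) ℤ.+ r₂ ℤ.* b₁) ℤ.* (b₁ ℤ.- b₂)
  sum = ℤ-Ring.solve-∀
  difference : ∀ r₁ r₂ b₁ b₂ → (b₁ ℤ.* b₁ ℤ.+ b₂ ℤ.* b₂) ℤ.* (r₁ ℤ.- r₂)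
             ≡ (r₁ ℤ.* b₁ ℤ.- r₂ ℤ.* (ℤ.- b₂)) ℤ.* (b₁ ℤ.- b₂) ℤ.+ (r₁ ℤ.* (ℤ.- b₂) ℤ.+ r₂ ℤ.* b₁) ℤ.* (ℤ.- (b₁ ℤ.+ b₂))
  difference = ℤ-Ring.solve-∀
  N∣r₁+r₂∣≤cV : N * ∣ r₁ ℤ.+ r₂ ∣ ≤ c * V
  N∣r₁+r₂∣≤cV = halve-bound (r₁ ℤ.+ r₂) (2N∣R∣≤c[∣p∣+∣q∣] {Nm b} X Y (b₁ ℤ.+ b₂) (b₁ ℤ.- b₂)
    (trans (cong (ℤ._* (r₁ ℤ.+ r₂)) (+Nm≡ b)) (sum r₁ r₂ b₁ b₂)) 2∣X∣≤c 2∣Y∣≤c)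
  N∣r₁-r₂∣≤cV : N * ∣ r₁ ℤ.- r₂ ∣ ≤ c * V
  N∣r₁-r₂∣≤cV = halve-bound (r₁ ℤ.- r₂) (subst (λ x → N * ∣ r₁ ℤ.- r₂ ∣ + N * ∣ r₁ ℤ.- r₂ ∣ ≤ c * x)
    (trans (cong (_+_ (∣ b₁ ℤ.- b₂ ∣)) (ℤ.∣-i∣≡∣i∣ (b₁ ℤ.+ b₂))) (ℕ.+-comm ∣ b₁ ℤ.- b₂ ∣ ∣ b₁ ℤ.+ b₂ ∣))
    (2N∣R∣≤c[∣p∣+∣q∣] {Nm b} X Y (b₁ ℤ.- b₂) (ℤ.- (b₁ ℤ.+ b₂))
      (trans (cong (ℤ._* (r₁ ℤ.- r₂)) (+Nm≡ b)) (difference r₁ r₂ b₁ b₂)) 2∣X∣≤c 2∣Y∣≤c))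

BoxedBelow : ℕ → ℕ → ℤ[i] → Set
BoxedBelow d M r = ∃[ n ] suc n ≡ 2 * d + M × Box n r

box-from-halves : ∀ {M₀ r b} → ∣ re r ∣ + ∣ re r ∣ ≤ ∥ b ∥₁ → ∣ im r ∣ + ∣ im r ∣ ≤ ∥ b ∥₁
                → ∥ b ∥₁ < W (suc (suc M₀)) → ∥ r ∥₁ < W (suc M₀) → Box M₀ r
box-from-halves {M₀} 2∣r₁∣≤ 2∣r₂∣≤ ∥b∥<W ∥r∥<W =
  m+m<n+n+2⇒m≤n _ (W M₀) (ℕ.≤-<-trans 2∣r₁∣≤ ∥b∥<W) , m+m<n+n+2⇒m≤n _ (W M₀) (ℕ.≤-<-trans 2∣r₂∣≤ ∥b∥<W) , ∥r∥<W

odd²+even²-odd : ∀ {x y} → Odd x → Even y → ∃[ t ] ∣ x ∣ * ∣ x ∣ + ∣ y ∣ * ∣ y ∣ ≡ suc (t + t)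
odd²+even²-odd o e with ∣odd∣ o | ∣even∣ e
... | a , ∣x∣≡ | h , ∣y∣≡ = 2 * a * a + 2 * a + 2 * h * h ,
  trans (cong₂ _+_ (cong₂ _*_ ∣x∣≡ ∣x∣≡) (cong₂ _*_ ∣y∣≡ ∣y∣≡)) (expand a h)
  where
  expand : ∀ a h → suc (a + a) * suc (a + a) + (h + h) * (h + h)
                 ≡ suc ((2 * a * a + 2 * a + 2 * h * h) + (2 * a * a + 2 * a + 2 * h * h))
  expand = ℕ-Ring.solve-∀

remainder-box-far : ∀ e {M r b} → 2∤ b → RemainderBound (2 ^ suc e * Nm b) r b → Box M b
                  → BoxedBelow (suc e) M r
remainder-box-far e {M} {r} {b} 2∤b bound (∣b₁∣≤W , ∣b₂∣≤W , ∥b∥<W) =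
  2 * e + suc M , index e M , ∣r∣≤W (2N∣r₁∣≤c∥b∥₁ r b bound) , ∣r∣≤W (2N∣r₂∣≤c∥b∥₁ r b bound) , ∥r∥<W
  where
  N = Nm b
  E = 2 ^ e
  instance
    N≢0 : ℕ.NonZero N
    N≢0 = ℕ.>-nonZero (Nm>0 (2∤⇒≢0 2∤b))
  index : ∀ e M → suc (2 * e + suc M) ≡ 2 * suc e + M
  index = ℕ-Ring.solve-∀
  ∣r∣≤W : ∀ {a} → N * a + N * a ≤ 2 ^ suc e * N * ∥ b ∥₁ → a ≤ W (2 * e + suc M)
  ∣r∣≤W {a} 2Na≤ = begin
    a                 ≤⟨ m+m≤n+n⇒m≤n a (E * ∥ b ∥₁) (ℕ.*-cancelˡ-≤ N (subst₂ _≤_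
                           (sym (ℕ.*-distribˡ-+ N a a)) (regroup E N ∥ b ∥₁) 2Na≤)) ⟩
    E * ∥ b ∥₁        ≤⟨ ℕ.*-monoʳ-≤ E (ℕ.<⇒≤ ∥b∥<W) ⟩
    E * W (suc M)     ≤⟨ 2^k*W≤W e (suc M) ⟩
    W (2 * e + suc M) ∎
    where
    open ℕ.≤-Reasoning
    regroup : ∀ E N x → 2 * E * N * x ≡ N * (E * x + E * x)
    regroup = ℕ-Ring.solve-∀
  ∥r∥<W : ∥ r ∥₁ < W (suc (2 * e + suc M))
  ∥r∥<W = begin-strict
    ∥ r ∥₁                   ≤⟨ ℕ.*-cancelˡ-≤ N (subst (N * ∥ r ∥₁ ≤_) (regroup (2 ^ suc e) N (W M))
                                  (N∥r∥₁≤cV r b (W M) bound ∣b₁∣≤W ∣b₂∣≤W)) ⟩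
    2 ^ suc e * W M          <⟨ 2^[1+k]*W<W e M ⟩
    W (2 * suc e + M)        ≡⟨ cong W (sym (index e M)) ⟩
    W (suc (2 * e + suc M))  ∎
    where
    open ℕ.≤-Reasoning
    regroup : ∀ D N x → D * N * x ≡ N * (D * x)
    regroup = ℕ-Ring.solve-∀

2∣r∣≤∥b∥₁ : ∀ {c a} b → ℕ.NonZero (Nm b) → c ≤ Nm b → Nm b * a + Nm b * a ≤ c * ∥ b ∥₁ → a + a ≤ ∥ b ∥₁
2∣r∣≤∥b∥₁ {a = a} b N≢0 c≤N 2Na≤ = ℕ.*-cancelˡ-≤ (Nm b) {{N≢0}}
  (subst (_≤ Nm b * ∥ b ∥₁) (sym (ℕ.*-distribˡ-+ (Nm b) a a)) (ℕ.≤-trans 2Na≤ (ℕ.*-monoˡ-≤ ∥ b ∥₁ c≤N)))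

remainder-box-odd-odd : ∀ {M r b} → Odd (re b) → Odd (im b) → 2∤ b → RemainderBound (Nm b) r b → Box M b
                      → BoxedBelow 0 M r
remainder-box-odd-odd {zero} o₁ o₂ _ _ box = ⊥-elim (odd-odd-¬box-0 o₁ o₂ box)
remainder-box-odd-odd {suc M₀} {r} {b} o₁ o₂ 2∤b bound (∣b₁∣≤W , ∣b₂∣≤W , ∥b∥<W) =
  M₀ , refl , box-from-halves {M₀} {r} {b} (2∣r∣≤∥b∥₁ b N≢0 ℕ.≤-refl (2N∣r₁∣≤c∥b∥₁ r b bound))
                              (2∣r∣≤∥b∥₁ b N≢0 ℕ.≤-refl (2N∣r₂∣≤c∥b∥₁ r b bound)) ∥b∥<W ∥r∥<W
  where
  N = Nm b
  N≢0 : ℕ.NonZero N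
  N≢0 = ℕ.>-nonZero (Nm>0 (2∤⇒≢0 2∤b))
  ∣b∣≤pred[W] : ∀ {x} → Odd x → ∣ x ∣ ≤ W (suc M₀) → ∣ x ∣ ≤ ℕ.pred (W (suc M₀))
  ∣b∣≤pred[W] o ∣x∣≤W with ∣odd∣ o
  ... | a , ∣x∣≡ = ℕ.<⇒≤pred (odd≤W⇒odd<W M₀ a ∣x∣≡ ∣x∣≤W)
  ∥r∥<W : ∥ r ∥₁ < W (suc M₀)
  ∥r∥<W = ℕ.m≤pred[n]⇒suc[m]≤n {{W≢0 (suc M₀)}} (ℕ.*-cancelˡ-≤ N {{N≢0}}
    (N∥r∥₁≤cV r b _ bound (∣b∣≤pred[W] o₁ ∣b₁∣≤W) (∣b∣≤pred[W] o₂ ∣b₂∣≤W)))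

remainder-box-odd-norm : ∀ {M r b} t → Nm b ≡ suc (t + t) → 2∤ r → RemainderBound (Nm b) r b → Box M b
                       → BoxedBelow 0 M r
remainder-box-odd-norm {M} {r} {b} t N≡ 2∤r (2∣X∣≤N , 2∣Y∣≤N) box@(∣b₁∣≤W , ∣b₂∣≤W , ∥b∥<W) = shrink M box ∥r∥<W
  where
  N = Nm b
  N≢0 : ℕ.NonZero N
  N≢0 = subst ℕ.NonZero (sym N≡) _
  2∣∣≤2t : ∀ {x} → ∣ x ∣ + ∣ x ∣ ≤ N → ∣ x ∣ + ∣ x ∣ ≤ t + t
  2∣∣≤2t {x} h = let ∣x∣≤t = m+m≤1+n+n⇒m≤n ∣ x ∣ t (subst (∣ x ∣ + ∣ x ∣ ≤_) N≡ h) in ℕ.+-mono-≤ ∣x∣≤t ∣x∣≤t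
  -- N is odd, so 2|X| ≤ N sharpens to 2|X| ≤ N - 1
  bound : RemainderBound (t + t) r b
  bound = 2∣∣≤2t {re (r ⊗ conj b)} 2∣X∣≤N , 2∣∣≤2t {im (r ⊗ conj b)} 2∣Y∣≤N
  2t≤N : t + t ≤ N
  2t≤N = subst (t + t ≤_) (sym N≡) (ℕ.n≤1+n (t + t))
  ∥r∥<W : ∥ r ∥₁ < W M
  ∥r∥<W = ℕ.m≤pred[n]⇒suc[m]≤n {{W≢0 M}} ([1+c]*s≤c*[1+V]⇒s≤V (t + t) ∥ r ∥₁ (ℕ.pred (W M))
    (subst₂ (λ n w → n * ∥ r ∥₁ ≤ (t + t) * w) N≡ (sym (ℕ.suc-pred (W M) {{W≢0 M}}))
      (N∥r∥₁≤cV r b (W M) bound ∣b₁∣≤W ∣b₂∣≤W)))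
  shrink : ∀ M → Box M b → ∥ r ∥₁ < W M → BoxedBelow 0 M r
  shrink zero _ (s≤s ∥r∥≤0) = ⊥-elim (2∤⇒≢0 2∤r (∥z∥₁≡0⇒z≡0 r (ℕ.n≤0⇒n≡0 ∥r∥≤0)))
  shrink (suc M₀) (_ , _ , ∥b∥<W) ∥r∥<W =
    M₀ , refl , box-from-halves {M₀} {r} {b} (2∣r∣≤∥b∥₁ b N≢0 2t≤N (2N∣r₁∣≤c∥b∥₁ r b bound))
                                (2∣r∣≤∥b∥₁ b N≢0 2t≤N (2N∣r₂∣≤c∥b∥₁ r b bound)) ∥b∥<W ∥r∥<W

remainder-box : ∀ d {M r b} → 2∤ r → 2∤ b → RemainderBound (2 ^ d * Nm b) r b → Box M b → BoxedBelow d M r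
remainder-box (suc e) {M} {r} {b} _ 2∤b bound box = remainder-box-far e {M} {r} {b} 2∤b bound box
remainder-box zero {M} {r} {b} 2∤r 2∤b (2∣X∣≤ , 2∣Y∣≤) box = near (2∤⇒oddParts 2∤b)
  where
  bound : RemainderBound (Nm b) r b
  bound = subst (∣ re (r ⊗ conj b) ∣ + ∣ re (r ⊗ conj b) ∣ ≤_) (ℕ.*-identityˡ (Nm b)) 2∣X∣≤
        , subst (∣ im (r ⊗ conj b) ∣ + ∣ im (r ⊗ conj b) ∣ ≤_) (ℕ.*-identityˡ (Nm b)) 2∣Y∣≤
  near : OddParts b → BoxedBelow 0 M r
  near (odd-odd o₁ o₂) = remainder-box-odd-odd {M} {r} o₁ o₂ 2∤b bound box
  near (odd-even o₁ e₂) with odd²+even²-odd o₁ e₂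
  ... | t , N≡ = remainder-box-odd-norm {M} t (trans (Nm≡ b) N≡) 2∤r bound box
  near (even-odd e₁ o₂) with odd²+even²-odd o₂ e₁
  ... | t , N≡ = remainder-box-odd-norm {M} t (trans (Nm≡ b) (trans (ℕ.+-comm (∣ re b ∣ * ∣ re b ∣) _) N≡)) 2∤r bound box

scaled-remainder-bound : ∀ j d {r b r′ b′} → r ≡ (2g ^g j) ⊗ r′ → b ≡ (2g ^g (j + d)) ⊗ b′
                       → RemainderBound (Nm b) r b → RemainderBound (2 ^ d * Nm b′) r′ b′
scaled-remainder-bound j d {r} {b} {r′@(x₁ + x₂ i)} {b′@(y₁ + y₂ i)} r≡ b≡ (2∣X∣≤ , 2∣Y∣≤) =
  cancel (re (r ⊗ conj b)) (cong (∣_∣ ∘ re) r⊗b̄≡) 2∣X∣≤ , cancel (im (r ⊗ conj b)) (cong (∣_∣ ∘ im) r⊗b̄≡) 2∣Y∣≤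
  where
  P = 2 ^ j
  Q = 2 ^ (j + d)
  D = 2 ^ d
  instance
    PQ≢0 : ℕ.NonZero (P * Q)
    PQ≢0 = ℕ.m*n≢0 P Q {{ℕ.m^n≢0 2 j}} {{ℕ.m^n≢0 2 (j + d)}}
  scale-re : ∀ p q x₁ x₂ y₁ y₂ → (p ℤ.* x₁) ℤ.* (q ℤ.* y₁) ℤ.- (p ℤ.* x₂) ℤ.* (ℤ.- (q ℤ.* y₂))
                               ≡ (p ℤ.* q) ℤ.* (x₁ ℤ.* y₁ ℤ.- x₂ ℤ.* (ℤ.- y₂))
  scale-re = ℤ-Ring.solve-∀
  scale-im : ∀ p q x₁ x₂ y₁ y₂ → (p ℤ.* x₁) ℤ.* (ℤ.- (q ℤ.* y₂)) ℤ.+ (p ℤ.* x₂) ℤ.* (q ℤ.* y₁)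
                               ≡ (p ℤ.* q) ℤ.* (x₁ ℤ.* (ℤ.- y₂) ℤ.+ x₂ ℤ.* y₁)
  scale-im = ℤ-Ring.solve-∀
  r⊗b̄≡ : r ⊗ conj b ≡ (+ P ℤ.* + Q ℤ.* re (r′ ⊗ conj b′)) + (+ P ℤ.* + Q ℤ.* im (r′ ⊗ conj b′)) i
  r⊗b̄≡ = trans (cong₂ (λ s t → s ⊗ conj t) (trans r≡ (2g^k⊗z≡ j r′)) (trans b≡ (2g^k⊗z≡ (j + d) b′)))
            (cong₂ _+_i (scale-re (+ P) (+ Q) x₁ x₂ y₁ y₂) (scale-im (+ P) (+ Q) x₁ x₂ y₁ y₂))
  Nm-b≡ : Nm b ≡ (P * Q) * (D * Nm b′)
  Nm-b≡ = begin
    Nm b                                                        ≡⟨ cong Nm (trans b≡ (2g^k⊗z≡ (j + d) b′)) ⟩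
    Nm ((+ Q ℤ.* y₁) + (+ Q ℤ.* y₂) i)                          ≡⟨ Nm≡ ((+ Q ℤ.* y₁) + (+ Q ℤ.* y₂) i) ⟩
    ∣ + Q ℤ.* y₁ ∣ * ∣ + Q ℤ.* y₁ ∣ + ∣ + Q ℤ.* y₂ ∣ * ∣ + Q ℤ.* y₂ ∣
      ≡⟨ cong₂ (λ a b → a * a + b * b) (ℤ.abs-* (+ Q) y₁) (ℤ.abs-* (+ Q) y₂) ⟩
    (Q * ∣ y₁ ∣) * (Q * ∣ y₁ ∣) + (Q * ∣ y₂ ∣) * (Q * ∣ y₂ ∣)   ≡⟨ cong (λ q → (q * ∣ y₁ ∣) * (Q * ∣ y₁ ∣) + (q * ∣ y₂ ∣) * (Q * ∣ y₂ ∣)) (ℕ.^-distribˡ-+-* 2 j d) ⟩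
    (P * D * ∣ y₁ ∣) * (Q * ∣ y₁ ∣) + (P * D * ∣ y₂ ∣) * (Q * ∣ y₂ ∣) ≡⟨ regroup P D Q ∣ y₁ ∣ ∣ y₂ ∣ ⟩
    (P * Q) * (D * (∣ y₁ ∣ * ∣ y₁ ∣ + ∣ y₂ ∣ * ∣ y₂ ∣))             ≡⟨ cong (λ n → (P * Q) * (D * n)) (sym (Nm≡ b′)) ⟩
    (P * Q) * (D * Nm b′)                                        ∎
    where
    open ≡-Reasoning
    regroup : ∀ p e q a b → (p * e * a) * (q * a) + (p * e * b) * (q * b) ≡ (p * q) * (e * (a * a + b * b))
    regroup = ℕ-Ring.solve-∀
  cancel : ∀ x {x′} → ∣ x ∣ ≡ ∣ + P ℤ.* + Q ℤ.* x′ ∣ → ∣ x ∣ + ∣ x ∣ ≤ Nm b → ∣ x′ ∣ + ∣ x′ ∣ ≤ D * Nm b′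
  cancel x {x′} ∣x∣≡ 2∣x∣≤ = ℕ.*-cancelˡ-≤ (P * Q) (subst₂ _≤_ 2∣x∣≡ Nm-b≡ 2∣x∣≤)
    where
    ∣x∣≡PQ∣x′∣ : ∣ x ∣ ≡ P * Q * ∣ x′ ∣
    ∣x∣≡PQ∣x′∣ = trans ∣x∣≡ (trans (ℤ.abs-* (+ P ℤ.* + Q) x′) (cong (_* ∣ x′ ∣) (ℤ.abs-* (+ P) (+ Q))))
    2∣x∣≡ : ∣ x ∣ + ∣ x ∣ ≡ P * Q * (∣ x′ ∣ + ∣ x′ ∣)
    2∣x∣≡ = trans (cong₂ _+_ ∣x∣≡PQ∣x′∣ ∣x∣≡PQ∣x′∣) (sym (ℕ.*-distribˡ-+ (P * Q) ∣ x′ ∣ ∣ x′ ∣))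

p-[p/N]*N≡p%N : ∀ p N .{{_ : ℕ.NonZero N}} → p ℤ.- (p ℤ./ℕ N) ℤ.* + N ≡ + (p ℤ.%ℕ N)
p-[p/N]*N≡p%N p N = trans (cong (ℤ._- (p ℤ./ℕ N) ℤ.* + N) (ℤ.a≡a%ℕn+[a/ℕn]*n p N)) (cancel (+ (p ℤ.%ℕ N)) ((p ℤ./ℕ N) ℤ.* + N))
  where
  cancel : ∀ x y → (x ℤ.+ y) ℤ.- y ≡ x
  cancel = ℤ-Ring.solve-∀

p-[p/N+1]*N≡-[N∸p%N] : ∀ p N .{{_ : ℕ.NonZero N}} → p ℤ.- ((p ℤ./ℕ N) ℤ.+ + 1) ℤ.* + N ≡ ℤ.- + (N ∸ p ℤ.%ℕ N)
p-[p/N+1]*N≡-[N∸p%N] p N = begin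
  p ℤ.- (q ℤ.+ + 1) ℤ.* + N                                        ≡⟨ cong (ℤ._- (q ℤ.+ + 1) ℤ.* + N) (ℤ.a≡a%ℕn+[a/ℕn]*n p N) ⟩
  (+ ρ ℤ.+ q ℤ.* + N) ℤ.- (q ℤ.+ + 1) ℤ.* + N                      ≡⟨ cong (λ n → (+ ρ ℤ.+ q ℤ.* n) ℤ.- (q ℤ.+ + 1) ℤ.* n) (cong +_ (sym ρ+δ≡N)) ⟩
  (+ ρ ℤ.+ q ℤ.* (+ ρ ℤ.+ + δ)) ℤ.- (q ℤ.+ + 1) ℤ.* (+ ρ ℤ.+ + δ)  ≡⟨ cancel (+ ρ) (+ δ) q ⟩
  ℤ.- (+ δ)                                                        ∎
  where
  open ≡-Reasoning
  ρ = p ℤ.%ℕ N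
  q = p ℤ./ℕ N
  δ = N ∸ ρ
  ρ+δ≡N : ρ + δ ≡ N
  ρ+δ≡N = ℕ.m+[n∸m]≡n (ℕ.<⇒≤ (ℤ.n%ℕd<d p N))
  cancel : ∀ x y q → (x ℤ.+ q ℤ.* (x ℤ.+ y)) ℤ.- (q ℤ.+ + 1) ℤ.* (x ℤ.+ y) ≡ ℤ.- y
  cancel = ℤ-Ring.solve-∀

2∣rounding-error∣≤N : ∀ p N → 0 < N → ∣ p ℤ.- roundDiv p N ℤ.* + N ∣ + ∣ p ℤ.- roundDiv p N ℤ.* + N ∣ ≤ N
2∣rounding-error∣≤N p N@(suc _) _ with 2 * (p ℤ.%ℕ N) ℕ.≤ᵇ N in 2ρ≤ᵇN
... | true  = subst (λ e → ∣ e ∣ + ∣ e ∣ ≤ N) (sym (p-[p/N]*N≡p%N p N))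
                (subst (_≤ N) (cong (_+_ ρ) (ℕ.+-identityʳ ρ)) (ℕ.≤ᵇ⇒≤ (2 * ρ) N (subst Bool.T (sym 2ρ≤ᵇN) tt)))
  where ρ = p ℤ.%ℕ N
... | false = subst (λ e → ∣ e ∣ + ∣ e ∣ ≤ N) (sym (p-[p/N+1]*N≡-[N∸p%N] p N))
                (subst (λ x → x + x ≤ N) (sym (ℤ.∣-i∣≡∣i∣ (+ (N ∸ ρ))))
                  (ℕ.<⇒≤ ([n∸m]+[n∸m]<n (ℕ.<⇒≤ (ℤ.n%ℕd<d p N)) N<ρ+ρ)))
  where
  ρ = p ℤ.%ℕ N
  N<ρ+ρ : N < ρ + ρ
  N<ρ+ρ = subst (N <_) (cong (_+_ ρ) (ℕ.+-identityʳ ρ)) (ℕ.≰⇒> λ 2ρ≤N → subst Bool.T 2ρ≤ᵇN (ℕ.≤⇒≤ᵇ 2ρ≤N))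

re-[a-qb]b̄ : ∀ a q b → re ((a ⊖ q ⊗ b) ⊗ conj b) ≡ re (a ⊗ conj b) ℤ.- re q ℤ.* + Nm b
re-[a-qb]b̄ (a₁ + a₂ i) (q₁ + q₂ i) b@(b₁ + b₂ i) =
  trans (expand a₁ a₂ b₁ b₂ q₁ q₂) (cong (λ n → (a₁ ℤ.* b₁ ℤ.- a₂ ℤ.* (ℤ.- b₂)) ℤ.- q₁ ℤ.* n) (sym (+Nm≡ b)))
  where
  expand : ∀ a₁ a₂ b₁ b₂ q₁ q₂
    → (a₁ ℤ.- (q₁ ℤ.* b₁ ℤ.- q₂ ℤ.* b₂)) ℤ.* b₁ ℤ.- (a₂ ℤ.- (q₁ ℤ.* b₂ ℤ.+ q₂ ℤ.* b₁)) ℤ.* (ℤ.- b₂)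
    ≡ (a₁ ℤ.* b₁ ℤ.- a₂ ℤ.* (ℤ.- b₂)) ℤ.- q₁ ℤ.* (b₁ ℤ.* b₁ ℤ.+ b₂ ℤ.* b₂)
  expand = ℤ-Ring.solve-∀

im-[a-qb]b̄ : ∀ a q b → im ((a ⊖ q ⊗ b) ⊗ conj b) ≡ im (a ⊗ conj b) ℤ.- im q ℤ.* + Nm b
im-[a-qb]b̄ (a₁ + a₂ i) (q₁ + q₂ i) b@(b₁ + b₂ i) =
  trans (expand a₁ a₂ b₁ b₂ q₁ q₂) (cong (λ n → (a₁ ℤ.* (ℤ.- b₂) ℤ.+ a₂ ℤ.* b₁) ℤ.- q₂ ℤ.* n) (sym (+Nm≡ b)))
  where
  expand : ∀ a₁ a₂ b₁ b₂ q₁ q₂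
    → (a₁ ℤ.- (q₁ ℤ.* b₁ ℤ.- q₂ ℤ.* b₂)) ℤ.* (ℤ.- b₂) ℤ.+ (a₂ ℤ.- (q₁ ℤ.* b₂ ℤ.+ q₂ ℤ.* b₁)) ℤ.* b₁
    ≡ (a₁ ℤ.* (ℤ.- b₂) ℤ.+ a₂ ℤ.* b₁) ℤ.- q₂ ℤ.* (b₁ ℤ.* b₁ ℤ.+ b₂ ℤ.* b₂)
  expand = ℤ-Ring.solve-∀

gaussRem-bound : ∀ a {b} → b ≢ 0g → RemainderBound (Nm b) (gaussRem a b) b
gaussRem-bound a {b} b≢0 =
    subst (λ e → ∣ e ∣ + ∣ e ∣ ≤ Nm b) (sym (re-[a-qb]b̄ a (gaussQuot a b) b))
      (2∣rounding-error∣≤N (re (a ⊗ conj b)) (Nm b) (Nm>0 b≢0))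
  , subst (λ e → ∣ e ∣ + ∣ e ∣ ≤ Nm b) (sym (im-[a-qb]b̄ a (gaussQuot a b) b))
      (2∣rounding-error∣≤N (im (a ⊗ conj b)) (Nm b) (Nm>0 b≢0))

-- n₀ is taken minimal because the box found for r′ depends on the expansion of b it comes from.
small-remainder⇒φ< : ∀ {r b} → r ≢ 0g → b ≢ 0g → RemainderBound (Nm b) r b
                    → ((j k : ℕ) → IsV2 r j → IsV2 b k → j ≤ k) → PhiLt r b
small-remainder⇒φ< {r} {b} r≢0 b≢0 bound v₂r≤v₂b with oddPart-of r r≢0 | oddPart-of b b≢0
... | oddPart j r′ r≡ 2∤r′ | oddPart k b′ b≡ 2∤b′ with least (λ n → box? n r′) {∥ r′ ∥₁} (∥z∥₁-box r′)
...   | n₀ , r′∈box , n₀-least with box⇒expansion n₀ r′ 2∤r′ r′∈box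
...     | l , l≤n₀ , r′-expansion =
  2 * j + l , subst (λ z → HasExpansion z (2 * j + l)) (sym r≡) (2g^k⊗-expansion r′-expansion j) , shorter
  where
  d = k ∸ j
  b≡′ : b ≡ (2g ^g (j + d)) ⊗ b′
  b≡′ = subst (λ e → b ≡ (2g ^g e) ⊗ b′)
          (sym (ℕ.m+[n∸m]≡n (v₂r≤v₂b j k (oddPart⇒IsV2 j r≡ 2∤r′) (oddPart⇒IsV2 k b≡ 2∤b′)))) b≡
  shorter : ∀ m → HasExpansion b m → 2 * j + l < m
  shorter m b-expansion =
    let M , m≡ , b′∈box = expansion⇒box b-expansion (j + d) b≡′ 2∤b′
        n , 1+n≡ , r′∈boxₙ = remainder-box d {M} 2∤r′ 2∤b′ (scaled-remainder-bound j d r≡ b≡′ bound) b′∈box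
    in subst (2 * j + l <_) (trans (cong (_+_ (2 * j)) 1+n≡) (trans (regroup j d M) (sym m≡)))
         (ℕ.+-monoʳ-< (2 * j) (s≤s (ℕ.≤-trans l≤n₀ (ℕ.≮⇒≥ λ n<n₀ → n₀-least n<n₀ r′∈boxₙ))))
    where
    regroup : ∀ j d M → 2 * j + (2 * d + M) ≡ 2 * (j + d) + M
    regroup = ℕ-Ring.solve-∀

lemma3 : (a b : ℤ[i]) → ¬ (a ≡ 0g) → ¬ (b ≡ 0g) →
    ¬ (gaussRem a b ≡ 0g) →
    ((j k : ℕ) → IsV2 (gaussRem a b) j → IsV2 b k → j ≤ k) →
    PhiLt (gaussRem a b) b
lemma3 a b _ b≢0 r≢0 v₂r≤v₂b = small-remainder⇒φ< r≢0 b≢0 (gaussRem-bound a b≢0) v₂r≤v₂b
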